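{- Let $H=\sum_{j\in J}H_j^2$ be an algebraic circuit over $\mathbb{Z}$ in variables $x_1,\dots,x_n$, formed from circuits $H_j$ (which may share nodes) by squaring gates on their outputs followed by a balanced binary tree of addition gates, and let $\mathrm{bit}_{t}(H)$ denote the sign bit (last entry) of $\mathrm{bit}(H)$. Then there is a boolean IPS proof of $\mathrm{bit}_t(H)=0$ using only the boolean axioms, of size polynomial in the size of $H$ and its syntactic length.
   Context: Boolean IPS proof of $g$ from the boolean axioms only: a circuit $C(\bar x,z_1,\dots,z_n)$ with $C(\bar x,\bar0)=0$ and $C(\bar x,x_1^2-x_1,\dots,x_n^2-x_n)=g$ formally; size = number of nodes. Syntactic length $\ell$: $\ell(x_j)=2$; for an integer leaf $\alpha$, least $k\ge1$ with $-2^{k-1}\le\alpha<2^{k-1}$; $\ell(G+H)=\max(\ell(G),\ell(H))+1$; $\ell(G\cdot H)=2\max(\ell(G),\ell(H))+3$. Two's complement: $\mathrm{val}(w_0,\dots,w_{k-1})=\sum_{i=0}^{k-2}2^iw_i-2^{k-1}w_{k-1}$, $w_{k-1}$ the sign bit; padding appends copies of the sign bit. Connectives: $a\wedge b=ab$, $a\vee b=1-(1-a)(1-b)$, $a\oplus b=a+b-2ab$. ADD of $\bar y,\bar z$ (padded to common length $t$; then $y_t=y_{t-1}$, $z_t=z_{t-1}$): $\mathrm{carry}_0=0$, $\mathrm{carry}_i=(y_{i-1}\wedge z_{i-1})\vee((y_{i-1}\vee z_{i-1})\wedge\mathrm{carry}_{i-1})$, output entries $y_i\oplus z_i\oplus\mathrm{carry}_i$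 for $0\le i\le t$. $\mathrm{ABS}(\bar x)=\mathrm{ADD}(\bar x,(s,\dots,s))\oplus(s,\dots,s)$ for sign bit $s$. $\mathrm{PROD}^+(\bar a,\bar b)$ for $t$-vectors: $\mathrm{ADD}(\bar s_{t-1},\mathrm{ADD}(\dots,\mathrm{ADD}(\bar s_1,\bar s_0)))$ where $\bar s_i$ has length $t+i$, $s_{i,j}=a_{j-i}\wedge b_i$ ($i\le j\le t-1+i$), $s_{i,j}=0$ ($j<i$). $\mathrm{PROD}(\bar y,\bar z)$: XOR every entry of $\mathrm{PROD}^+(\mathrm{ABS}(\bar y),\mathrm{ABS}(\bar z))$ with $s=y_{t-1}\oplus z_{t-1}$, then ADD the nonnegative integer $s$. $\mathrm{bit}(F)$ (with sharing): $\mathrm{bit}(x_j)=(x_j,0)$; integer leaf: its $\ell(\alpha)$-bit two's complement representation; $\mathrm{bit}(G+H)=\mathrm{ADD}(\mathrm{bit}G,\mathrm{bit}H)$; $\mathrm{bit}(G\cdot H)=\mathrm{PROD}(\mathrm{bit}G,\mathrm{bit}H)$, shorter padded first. $\mathrm{bit}(F)$ has $\ell(F)$ entries, so the sign bit is $\mathrm{bit}_{\ell(F)-1}(F)$. -}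

module Defs where

open import Data.Nat as ℕ using (ℕ; zero; suc; _⊔_; _∸_; _^_)
open import Data.Nat.Logarithm using (⌈log₂_⌉)
open import Data.Integer as ℤ using (ℤ; +_; -[1+_]; ∣_∣)
import Data.Integer.Properties as ℤP
open import Data.Fin using (Fin)
import Data.Fin.Properties as FinP
open import Data.Sum using (_⊎_; inj₁; inj₂)
open import Data.Product using (_×_)
import Data.Sum.Properties as SumP
open import Data.Bool using (Bool; true; false; if_then_else_; _∧_)
open import Data.List using (List; []; _∷_; _++_; map; replicate; length; foldl; deduplicate)
open import Relation.Binary.Definitions using (DecidableEquality)
open import Relation.Binary.PropositionalEquality using (_≡_; refl; cong; cong₂)
open import Relation.Nullary using (yes; no; does)

-- Algebraic circuits over ℤ (as terms; sharing is accounted for by `size`)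

infixl 6 _⊕c_
infixl 7 _⊗c_

data Circ (V : Set) : Set where
  var   : V → Circ V
  const : ℤ → Circ V
  _⊕c_  : Circ V → Circ V → Circ V
  _⊗c_  : Circ V → Circ V → Circ V

module _ {V : Set} (_≟V_ : DecidableEquality V) where
  infix 4 _≟C_
  _≟C_ : DecidableEquality (Circ V)
  var a ≟C var b with a ≟V b
  ... | yes refl = yes refl
  ... | no ¬p = no λ { refl → ¬p refl }
  var _ ≟C const _ = no λ ()
  var _ ≟C (_ ⊕c _) = no λ ()
  var _ ≟C (_ ⊗c _) = no λ ()
  const _ ≟C var _ = no λ ()
  const a ≟C const b with a ℤP.≟ b
  ... | yes refl = yes refl
  ... | no ¬p = no λ { refl → ¬p refl }
  const _ ≟C (_ ⊕c _) = no λ ()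
  const _ ≟C (_ ⊗c _) = no λ ()
  (_ ⊕c _) ≟C var _ = no λ ()
  (_ ⊕c _) ≟C const _ = no λ ()
  (a ⊕c b) ≟C (c ⊕c d) with a ≟C c | b ≟C d
  ... | yes refl | yes refl = yes refl
  ... | no ¬p | _ = no λ { refl → ¬p refl }
  ... | yes _ | no ¬q = no λ { refl → ¬q refl }
  (_ ⊕c _) ≟C (_ ⊗c _) = no λ ()
  (_ ⊗c _) ≟C var _ = no λ ()
  (_ ⊗c _) ≟C const _ = no λ ()
  (_ ⊗c _) ≟C (_ ⊕c _) = no λ ()
  (a ⊗c b) ≟C (c ⊗c d) with a ≟C c | b ≟C d
  ... | yes refl | yes refl = yes refl
  ... | no ¬p | _ = no λ { refl → ¬p refl }
  ... | yes _ | no ¬q = no λ { refl → ¬q refl }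

  subterms : Circ V → List (Circ V)
  subterms e@(var _)   = e ∷ []
  subterms e@(const _) = e ∷ []
  subterms e@(a ⊕c b)  = e ∷ subterms a ++ subterms b
  subterms e@(a ⊗c b)  = e ∷ subterms a ++ subterms b

  -- size = number of nodes of the circuit with maximal sharing
  -- (= number of distinct subcircuits)
  size : Circ V → ℕ
  size C = length (deduplicate _≟C_ (subterms C))

sizeX : ∀ {n} → Circ (Fin n) → ℕ
sizeX = size FinP._≟_

sizeXZ : ∀ {n} → Circ (Fin n ⊎ Fin n) → ℕ
sizeXZ = size (SumP.≡-dec FinP._≟_ FinP._≟_)

-- Formal (polynomial) equality: the congruence generated by the
-- commutative ring axioms, with integer constants computed in ℤ.
-- Its quotient is exactly the polynomial ring ℤ[V].

infix 4 _≈_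
data _≈_ {V : Set} : Circ V → Circ V → Set where
  ≈-refl  : ∀ {a} → a ≈ a
  ≈-sym   : ∀ {a b} → a ≈ b → b ≈ a
  ≈-trans : ∀ {a b c} → a ≈ b → b ≈ c → a ≈ c
  ⊕-cong  : ∀ {a b c d} → a ≈ b → c ≈ d → a ⊕c c ≈ b ⊕c d
  ⊗-cong  : ∀ {a b c d} → a ≈ b → c ≈ d → a ⊗c c ≈ b ⊗c d
  ⊕-assoc : ∀ a b c → (a ⊕c b) ⊕c c ≈ a ⊕c (b ⊕c c)
  ⊕-comm  : ∀ a b → a ⊕c b ≈ b ⊕c a
  ⊕-identityˡ : ∀ a → const (+ 0) ⊕c a ≈ a
  ⊕-inverseʳ  : ∀ a → a ⊕c (const (ℤ.- (+ 1)) ⊗c a) ≈ const (+ 0)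
  ⊗-assoc : ∀ a b c → (a ⊗c b) ⊗c c ≈ a ⊗c (b ⊗c c)
  ⊗-comm  : ∀ a b → a ⊗c b ≈ b ⊗c a
  ⊗-identityˡ : ∀ a → const (+ 1) ⊗c a ≈ a
  distribˡ : ∀ a b c → a ⊗c (b ⊕c c) ≈ (a ⊗c b) ⊕c (a ⊗c c)
  const-⊕ : ∀ α β → const α ⊕c const β ≈ const (α ℤ.+ β)
  const-⊗ : ∀ α β → const α ⊗c const β ≈ const (α ℤ.* β)

_⟪_⟫ : ∀ {V W} → Circ V → (V → Circ W) → Circ W
var v ⟪ σ ⟫ = σ v
const α ⟪ σ ⟫ = const α
(a ⊕c b) ⟪ σ ⟫ = (a ⟪ σ ⟫) ⊕c (b ⟪ σ ⟫)
(a ⊗c b) ⟪ σ ⟫ = (a ⟪ σ ⟫) ⊗c (b ⟪ σ ⟫)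

-- Boolean IPS proofs from the boolean axioms only.
-- C(x̄, z̄): variables inj₁ j = x_j, inj₂ j = z_j.

zeroSub : ∀ {n} → Fin n ⊎ Fin n → Circ (Fin n)
zeroSub (inj₁ j) = var j
zeroSub (inj₂ j) = const (+ 0)

boolSub : ∀ {n} → Fin n ⊎ Fin n → Circ (Fin n)
boolSub (inj₁ j) = var j
boolSub (inj₂ j) = (var j ⊗c var j) ⊕c (const (ℤ.- (+ 1)) ⊗c var j)

IsBoolIPSProof : ∀ {n} → Circ (Fin n ⊎ Fin n) → Circ (Fin n) → Set
IsBoolIPSProof C g = (C ⟪ zeroSub ⟫ ≈ const (+ 0)) × (C ⟪ boolSub ⟫ ≈ g)

fits : ℕ → ℤ → Bool
fits k α = does (ℤ.- (+ (2 ^ (k ∸ 1))) ℤP.≤? α) ∧ does (α ℤP.<? + (2 ^ (k ∸ 1)))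

searchLen : ℕ → ℕ → ℤ → ℕ
searchLen zero k α = k
searchLen (suc f) k α = if fits k α then k else searchLen f (suc k) α

-- ℓ(α) = least k ≥ 1 with -2^(k-1) ≤ α < 2^(k-1)
-- (k = ∣α∣ + 1 always fits, so the search with fuel ∣α∣ is exhaustive)
ℓint : ℤ → ℕ
ℓint α = searchLen ∣ α ∣ 1 α

ℓ : ∀ {V} → Circ V → ℕ
ℓ (var _) = 2
ℓ (const α) = ℓint α
ℓ (G ⊕c H) = suc (ℓ G ⊔ ℓ H)
ℓ (G ⊗c H) = 2 ℕ.* (ℓ G ⊔ ℓ H) ℕ.+ 3

module _ {V : Set} where
  private
    C = Circ V

  𝟘 𝟙 : C
  𝟘 = const (+ 0)
  𝟙 = const (+ 1)

  neg : C → C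
  neg a = 𝟙 ⊕c (const (ℤ.- (+ 1)) ⊗c a)

  AND OR XOR : C → C → C
  AND a b = a ⊗c b
  OR a b = neg (neg a ⊗c neg b)
  XOR a b = (a ⊕c b) ⊕c (const (ℤ.- (+ 2)) ⊗c (a ⊗c b))

  -- last entry (the sign bit); the default is never used on the
  -- nonempty vectors arising below
  lastOr : C → List C → C
  lastOr d [] = d
  lastOr d (x ∷ xs) = lastOr x xs

  pad : ℕ → List C → List C
  pad k ys = ys ++ replicate (k ∸ length ys) (lastOr 𝟘 ys)

  addAux : C → List C → List C → List C
  addAux c (y ∷ ys) (z ∷ zs) =
    XOR (XOR y z) c ∷ addAux (OR (AND y z) (AND (OR y z) c)) ys zs
  addAux c _ _ = []

  ADD : List C → List C → List C
  ADD ys zs = addAux 𝟘 (pad (suc t) ys) (pad (suc t) zs)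
    where t = length ys ⊔ length zs

  ABS : List C → List C
  ABS xs = map (λ e → XOR e s) (ADD xs (replicate (length xs) s))
    where s = lastOr 𝟘 xs

  rows : List C → ℕ → List C → List (List C)
  rows as i [] = []
  rows as i (b ∷ bs) = (replicate i 𝟘 ++ map (λ a → AND a b) as) ∷ rows as (suc i) bs

  sumRows : List (List C) → List C
  sumRows [] = []
  sumRows (r₀ ∷ rs) = foldl (λ acc r → ADD r acc) r₀ rs

  PROD⁺ : List C → List C → List C
  PROD⁺ as bs = sumRows (rows as 0 bs)

  PROD : List C → List C → List C
  PROD ys zs = ADD (map (λ e → XOR e s) (PROD⁺ (ABS ys′) (ABS zs′))) (s ∷ 𝟘 ∷ [])
    where
      t = length ys ⊔ length zs
      ys′ = pad t ys
      zs′ = pad t zs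
      s = XOR (lastOr 𝟘 ys′) (lastOr 𝟘 zs′)

digits : ℕ → ℕ → List ℕ
digits zero u = []
digits (suc k) u = (u ℕ.% 2) ∷ digits k (u ℕ./ 2)

-- k-bit two's complement representation of α (for -2^(k-1) ≤ α < 2^(k-1)):
-- the k binary digits of α mod 2^k
twosComp : ℕ → ℤ → List ℕ
twosComp k (+ m) = digits k m
twosComp k -[1+ m ] = digits k (2 ^ k ∸ suc m)

bit : ∀ {V} → Circ V → List (Circ V)
bit (var j) = var j ∷ const (+ 0) ∷ []
bit (const α) = map (λ w → const (+ w)) (twosComp (ℓint α) α)
bit (G ⊕c H) = ADD (bit G) (bit H)
bit (G ⊗c H) = PROD (bit G) (bit H)

signBit : ∀ {V} → Circ V → Circ V
signBit F = lastOr 𝟘 (bit F)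

data SqTree (V : Set) : Set where
  leaf : Circ V → SqTree V
  node : SqTree V → SqTree V → SqTree V

toCirc : ∀ {V} → SqTree V → Circ V
toCirc (leaf H) = H ⊗c H
toCirc (node T U) = toCirc T ⊕c toCirc U

leaves : ∀ {V} → SqTree V → ℕ
leaves (leaf _) = 1
leaves (node T U) = leaves T ℕ.+ leaves U

depth : ∀ {V} → SqTree V → ℕ
depth (leaf _) = 0
depth (node T U) = suc (depth T ⊔ depth U)

Balanced : ∀ {V} → SqTree V → Set
Balanced T = depth T ℕ.≤ ⌈log₂ leaves T ⌉

module Submission where

-- The sign bit lies in the ideal of ℤ[x̄] generated by the boolean axioms x² − x, and a witness
-- C(x̄, z̄) for this is assembled bottom-up along the construction of bit(H).  Every entry of a
-- bit vector is a boolean combination of variables, so b² − b lies in the ideal for each of them.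
-- For a leaf H² the product sign is a ⊕ a = −2(a² − a) for the sign bit a of bit(H); the top bit
-- of ABS is a multiple of a² − a, the top bits of the shifted rows of PROD⁺ are multiples of the
-- top bit of ABS, and the last output bit of ADD lies in the ideal generated by the sign bits of
-- its two summands.  This carries membership through PROD and up the tree of additions.
-- For the size: every step of the witness is an instance of a fixed template applied to nodes of
-- the bit vectors of the distinct subcircuits of H, and each of those has O(ℓ(H)²) nodes, so the
-- witness has size polynomial in size(H) and ℓ(H).

open import Defs
open import Algebra.Solver.Ring.AlmostCommutativeRing
  using (AlmostCommutativeRing; _-Raw-AlmostCommutative⟶_)
import Algebra.Structures as AS
import Algebra.Structures.Biased as Biased
import Algebra.Solver.Ring as RingSolver
open import Data.Empty using (⊥-elim)
open import Data.Fin using (Fin; zero; suc)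
import Data.Fin.Properties as FinP
open import Data.Integer as ℤ using (ℤ; +_; -[1+_])
import Data.Integer.Properties as ℤP
open import Data.List
  using (List; []; _∷_; _++_; map; replicate; length; foldl; concat; concatMap; deduplicate)
import Data.List.Properties as LP
open import Data.List.Membership.Propositional using (_∈_)
open import Data.List.Membership.Propositional.Properties
  using (∈-++⁻; ∈-++⁺ˡ; ∈-++⁺ʳ; ∈-∃++; ∈-deduplicate⁻; ∈-deduplicate⁺; ∈-concatMap⁺; ∈-map⁺)
open import Data.List.Relation.Binary.Pointwise using (Pointwise; []; _∷_)
open import Data.List.Relation.Unary.All as All using (All; []; _∷_)
import Data.List.Relation.Unary.All.Properties as AllP
open import Data.List.Relation.Unary.AllPairs using (_∷_)
open import Data.List.Relation.Unary.Any as Any using (here; there)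
open import Data.List.Relation.Unary.Unique.Propositional using (Unique)
open import Data.List.Relation.Unary.Unique.DecPropositional.Properties using (deduplicate-!)
open import Data.Maybe using (Maybe; just; nothing)
open import Data.Nat using (ℕ; zero; suc; _+_; _*_; _^_; _≤_; _<_; _⊔_; _∸_; s≤s; z≤n)
import Data.Nat.DivMod as ℕD
open import Data.Nat.ListAction using (sum)
import Data.Nat.Properties as ℕP
import Data.Nat.Solver
open import Data.Product using (Σ; _×_; _,_)
open import Data.Sum using (_⊎_; inj₁; inj₂; [_,_]′)
open import Data.Vec using (Vec; lookup; _∷_; [])
import Data.Vec.Relation.Unary.All as VAll
import Data.Vec.Relation.Unary.All.Properties as VAllP
open import Function using (_∘_)
open import Relation.Binary.Bundles using (Setoid)
open import Relation.Binary.Definitions using (DecidableEquality)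
import Relation.Binary.Reasoning.Setoid as ≈-Reasoning
open import Relation.Binary.Structures using (IsEquivalence)
open import Relation.Binary.PropositionalEquality as ≡ using (_≡_; _≢_; refl)
open import Relation.Nullary using (yes; no)

module ℕS = Data.Nat.Solver.+-*-Solver

boolAx : ∀ {V} → Circ V → Circ V
boolAx x = (x ⊗c x) ⊕c (const (ℤ.- (+ 1)) ⊗c x)

carry : ∀ {V} → Circ V → Circ V → Circ V → Circ V
carry y z c = OR (AND y z) (AND (OR y z) c)

-- xorSlope s = 1 − 2s and xorCofactor a = (1 − 2a)²:  XOR x s = (1 − 2s) x + s  and
-- boolAx (XOR a b) = boolAx a + (1 − 2a)² boolAx b.
xorSlope xorCofactor : ∀ {V} → Circ V → Circ V
xorSlope s = 𝟙 ⊕c const (ℤ.- + 2) ⊗c s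
xorCofactor a = 𝟙 ⊕c const (+ 4) ⊗c (a ⊗c a) ⊕c const (ℤ.- + 4) ⊗c a

-- Formal equality as a commutative ring

module CircuitRing (V : Set) where

  private
    C = Circ V
    -1c : C
    -1c = const (ℤ.- (+ 1))

  ≡⇒≈ : {a b : C} → a ≡ b → a ≈ b
  ≡⇒≈ refl = ≈-refl

  ≈-isEquivalence : IsEquivalence (_≈_ {V})
  ≈-isEquivalence = record { refl = ≈-refl ; sym = ≈-sym ; trans = ≈-trans }

  ≈-setoid : Setoid _ _
  ≈-setoid = record { isEquivalence = ≈-isEquivalence }

  ⊕-identityʳ : (a : C) → a ⊕c 𝟘 ≈ a
  ⊕-identityʳ a = ≈-trans (⊕-comm a 𝟘) (⊕-identityˡ a)

  ⊗-distribʳ : (a b c : C) → (b ⊕c c) ⊗c a ≈ (b ⊗c a) ⊕c (c ⊗c a)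
  ⊗-distribʳ a b c =
    ≈-trans (⊗-comm _ a) (≈-trans (distribˡ a b c) (⊕-cong (⊗-comm a b) (⊗-comm a c)))

  ⊗-zeroˡ : (a : C) → 𝟘 ⊗c a ≈ 𝟘
  ⊗-zeroˡ a = begin
    x                          ≈⟨ ⊕-identityʳ x ⟨
    x ⊕c 𝟘                     ≈⟨ ⊕-cong ≈-refl (⊕-inverseʳ x) ⟨
    x ⊕c (x ⊕c -1c ⊗c x)       ≈⟨ ⊕-assoc x x (-1c ⊗c x) ⟨
    x ⊕c x ⊕c -1c ⊗c x         ≈⟨ ⊕-cong x⊕x≈x ≈-refl ⟩
    x ⊕c -1c ⊗c x              ≈⟨ ⊕-inverseʳ x ⟩
    𝟘                          ∎
    where
      open ≈-Reasoning ≈-setoid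
      x = 𝟘 ⊗c a
      x⊕x≈x : x ⊕c x ≈ x
      x⊕x≈x = ≈-trans (≈-sym (⊗-distribʳ a 𝟘 𝟘)) (⊗-cong (const-⊕ (+ 0) (+ 0)) ≈-refl)

  isCommutativeSemiring : AS.IsCommutativeSemiring _≈_ _⊕c_ _⊗c_ 𝟘 𝟙
  isCommutativeSemiring = Biased.isCommutativeSemiringˡ record
    { +-isCommutativeMonoid = record
      { isMonoid = record
        { isSemigroup = record { isMagma = magma ⊕-cong ; assoc = ⊕-assoc }
        ; identity = ⊕-identityˡ , ⊕-identityʳ }
      ; comm = ⊕-comm }
    ; *-isCommutativeMonoid = record
      { isMonoid = record
        { isSemigroup = record { isMagma = magma ⊗-cong ; assoc = ⊗-assoc }
        ; identity = ⊗-identityˡ , λ a → ≈-trans (⊗-comm a 𝟙) (⊗-identityˡ a) }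
      ; comm = ⊗-comm }
    ; distribʳ = ⊗-distribʳ
    ; zeroˡ = ⊗-zeroˡ }
    where
      magma : ∀ {_∙_} → (∀ {a b c d} → a ≈ b → c ≈ d → (a ∙ c) ≈ (b ∙ d)) → AS.IsMagma _≈_ _∙_
      magma cong = record { isEquivalence = ≈-isEquivalence ; ∙-cong = cong }

  almostCommutativeRing : AlmostCommutativeRing _ _
  almostCommutativeRing = record
    { Carrier = C ; _≈_ = _≈_ ; _+_ = _⊕c_ ; _*_ = _⊗c_ ; -_ = -1c ⊗c_ ; 0# = 𝟘 ; 1# = 𝟙
    ; isAlmostCommutativeRing = record
      { isCommutativeSemiring = isCommutativeSemiring
      ; -‿cong = ⊗-cong ≈-refl
      ; -‿*-distribˡ = ⊗-assoc -1c
      ; -‿+-comm = λ x y → ≈-sym (distribˡ -1c x y) } }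

  const-homomorphism : ℤ.+-*-rawRing -Raw-AlmostCommutative⟶ almostCommutativeRing
  const-homomorphism = record
    { ⟦_⟧ = const
    ; +-homo = λ a b → ≈-sym (const-⊕ a b)
    ; *-homo = λ a b → ≈-sym (const-⊗ a b)
    ; -‿homo = λ a →
        ≈-trans (≡⇒≈ (≡.cong const (≡.sym (ℤP.-1*i≡-i a)))) (≈-sym (const-⊗ (ℤ.- (+ 1)) a))
    ; 0-homo = ≈-refl
    ; 1-homo = ≈-refl }

  const-≈? : (a b : ℤ) → Maybe (_≈_ {V} (const a) (const b))
  const-≈? a b with a ℤP.≟ b
  ... | yes refl = just ≈-refl
  ... | no _ = nothing

  open RingSolver ℤ.+-*-rawRing almostCommutativeRing const-homomorphism const-≈? public

  negᴾ boolAxᴾ : ∀ {k} → Polynomial k → Polynomial k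
  negᴾ a = con (+ 1) :+ (con (ℤ.- (+ 1)) :* a)
  boolAxᴾ a = (a :* a) :+ (con (ℤ.- (+ 1)) :* a)

  ANDᴾ ORᴾ XORᴾ : ∀ {k} → Polynomial k → Polynomial k → Polynomial k
  ANDᴾ a b = a :* b
  ORᴾ a b = negᴾ (negᴾ a :* negᴾ b)
  XORᴾ a b = (a :+ b) :+ (con (ℤ.- (+ 2)) :* (a :* b))

  carryᴾ : ∀ {k} → Polynomial k → Polynomial k → Polynomial k → Polynomial k
  carryᴾ y z c = ORᴾ (ANDᴾ y z) (ANDᴾ (ORᴾ y z) c)

  xorSlopeᴾ xorCofactorᴾ : ∀ {k} → Polynomial k → Polynomial k
  xorSlopeᴾ s = con (+ 1) :+ con (ℤ.- + 2) :* s
  xorCofactorᴾ a = con (+ 1) :+ con (+ 4) :* (a :* a) :+ con (ℤ.- + 4) :* a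

  _⟪_⟫ᴾ : ∀ {k m} → Circ (Fin k) → (Fin k → Polynomial m) → Polynomial m
  var i ⟪ ρ ⟫ᴾ = ρ i
  const α ⟪ ρ ⟫ᴾ = con α
  (a ⊕c b) ⟪ ρ ⟫ᴾ = (a ⟪ ρ ⟫ᴾ) :+ (b ⟪ ρ ⟫ᴾ)
  (a ⊗c b) ⟪ ρ ⟫ᴾ = (a ⟪ ρ ⟫ᴾ) :* (b ⟪ ρ ⟫ᴾ)

⟪⟫-⟪⟫ : ∀ {U V W} (t : Circ U) (σ : U → Circ V) (τ : V → Circ W) →
  (t ⟪ σ ⟫) ⟪ τ ⟫ ≡ t ⟪ (λ v → σ v ⟪ τ ⟫) ⟫
⟪⟫-⟪⟫ (var x) σ τ = refl
⟪⟫-⟪⟫ (const x) σ τ = refl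
⟪⟫-⟪⟫ (a ⊕c b) σ τ = ≡.cong₂ _⊕c_ (⟪⟫-⟪⟫ a σ τ) (⟪⟫-⟪⟫ b σ τ)
⟪⟫-⟪⟫ (a ⊗c b) σ τ = ≡.cong₂ _⊗c_ (⟪⟫-⟪⟫ a σ τ) (⟪⟫-⟪⟫ b σ τ)

⟪var⟫ : ∀ {V} (t : Circ V) {σ : V → Circ V} → (∀ v → σ v ≡ var v) → t ⟪ σ ⟫ ≡ t
⟪var⟫ (var x) h = h x
⟪var⟫ (const x) h = refl
⟪var⟫ (a ⊕c b) h = ≡.cong₂ _⊕c_ (⟪var⟫ a h) (⟪var⟫ b h)
⟪var⟫ (a ⊗c b) h = ≡.cong₂ _⊗c_ (⟪var⟫ a h) (⟪var⟫ b h)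

-- The last output bit of ADD

module _ {V : Set} where

  private
    C = Circ V

  lastOr-map : (f : C → C) (d : C) (xs : List C) → lastOr (f d) (map f xs) ≡ f (lastOr d xs)
  lastOr-map f d [] = refl
  lastOr-map f d (x ∷ xs) = lastOr-map f x xs

  lastOr-++-∷ : (d : C) (xs : List C) (y : C) (ys : List C) → lastOr d (xs ++ y ∷ ys) ≡ lastOr y ys
  lastOr-++-∷ d [] y ys = refl
  lastOr-++-∷ d (x ∷ xs) y ys = lastOr-++-∷ x xs y ys

  lastOr-replicate : (s : C) (k : ℕ) → lastOr s (replicate k s) ≡ s
  lastOr-replicate s zero = refl
  lastOr-replicate s (suc k) = lastOr-replicate s k

  lastOr-All : ∀ {P : C → Set} {d} xs → P d → All P xs → P (lastOr d xs)
  lastOr-All [] pd [] = pd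
  lastOr-All (x ∷ xs) pd (px ∷ pxs) = lastOr-All xs px pxs

  All-pad : ∀ {P : C → Set} (k : ℕ) {ys} → P 𝟘 → All P ys → All P (pad k ys)
  All-pad k {ys} p𝟘 pys = AllP.++⁺ pys (AllP.replicate⁺ (k ∸ length ys) (lastOr-All ys p𝟘 pys))

  data EndsTwice (s : C) : List C → Set where
    [s,s] : EndsTwice s (s ∷ s ∷ [])
    _∷_ : ∀ x {L} → EndsTwice s L → EndsTwice s (x ∷ L)

  2≤length : ∀ {s L} → EndsTwice s L → 2 ≤ length L
  2≤length [s,s] = s≤s (s≤s z≤n)
  2≤length (x ∷ e) = ℕP.m≤n⇒m≤1+n (2≤length e)

  -- The last output bit of ADD when the padded summands end in y, y and z, z and c is the carry
  -- into the penultimate position.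
  topBit : C → C → C → C
  topBit y z c = XOR (XOR y z) (carry y z c)

  penultimateCarry : C → C → C → List C → List C → C
  penultimateCarry c p₁ p₂ (y ∷ ys) (z ∷ zs) = penultimateCarry (carry y z c) c p₁ ys zs
  penultimateCarry c p₁ p₂ [] [] = p₂
  penultimateCarry c p₁ p₂ _ _ = 𝟘

  lastOr-addAux : ∀ {sy sz Y Z} → EndsTwice sy Y → EndsTwice sz Z → length Y ≡ length Z →
    ∀ c p₁ p₂ d → lastOr d (addAux c Y Z) ≡ topBit sy sz (penultimateCarry c p₁ p₂ Y Z)
  lastOr-addAux [s,s] [s,s] _ c p₁ p₂ d = refl
  lastOr-addAux [s,s] (_ ∷ ez) eq = ⊥-elim (ℕP.<-irrefl (ℕP.suc-injective eq) (2≤length ez))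
  lastOr-addAux (_ ∷ ey) [s,s] eq = ⊥-elim (ℕP.<-irrefl (ℕP.suc-injective (≡.sym eq)) (2≤length ey))
  lastOr-addAux (y ∷ ey) (z ∷ ez) eq c p₁ p₂ d =
    lastOr-addAux ey ez (ℕP.suc-injective eq) (carry y z c) c p₁ (XOR (XOR y z) c)

  endsTwice-replicate : (s : C) (k : ℕ) → EndsTwice s (replicate (suc (suc k)) s)
  endsTwice-replicate s zero = [s,s]
  endsTwice-replicate s (suc k) = s ∷ endsTwice-replicate s k

  endsTwice-++-replicate : (x : C) (xs : List C) (k : ℕ) →
    EndsTwice (lastOr x xs) ((x ∷ xs) ++ replicate (suc k) (lastOr x xs))
  endsTwice-++-replicate x [] = endsTwice-replicate x
  endsTwice-++-replicate x (y ∷ ys) k = x ∷ endsTwice-++-replicate y ys k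

  length-pad : (k : ℕ) (ys : List C) → length ys ≤ k → length (pad k ys) ≡ k
  length-pad k ys le = begin
    length (ys ++ replicate (k ∸ length ys) _) ≡⟨ LP.length-++ ys ⟩
    length ys + length (replicate (k ∸ length ys) _)
      ≡⟨ ≡.cong (λ m → length ys + m) (LP.length-replicate (k ∸ length ys)) ⟩
    length ys + (k ∸ length ys) ≡⟨ ℕP.m+[n∸m]≡n le ⟩
    k ∎
    where open ≡.≡-Reasoning

  pad-endsTwice : (t : ℕ) (ys : List C) → length ys ≤ t → 1 ≤ t →
    EndsTwice (lastOr 𝟘 ys) (pad (suc t) ys)
  pad-endsTwice (suc t) [] _ _ = endsTwice-replicate 𝟘 t
  pad-endsTwice t (x ∷ xs) le _ =
    ≡.subst (λ k → EndsTwice (lastOr x xs) ((x ∷ xs) ++ replicate k (lastOr x xs)))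
      (≡.sym (ℕP.+-∸-assoc 1 le)) (endsTwice-++-replicate x xs _)

  addWidth : List C → List C → ℕ
  addWidth ys zs = length ys ⊔ length zs

  addCarry : List C → List C → C
  addCarry ys zs = penultimateCarry 𝟘 𝟘 𝟘 (pad (suc t) ys) (pad (suc t) zs)
    where t = addWidth ys zs

  record PaddedSummands (ys zs : List C) : Set where
    field
      endsTwiceˡ : EndsTwice (lastOr 𝟘 ys) (pad (suc (addWidth ys zs)) ys)
      endsTwiceʳ : EndsTwice (lastOr 𝟘 zs) (pad (suc (addWidth ys zs)) zs)
      sameLength : length (pad (suc (addWidth ys zs)) ys) ≡ length (pad (suc (addWidth ys zs)) zs)

  paddedSummands : (ys zs : List C) → 1 ≤ addWidth ys zs → PaddedSummands ys zs
  paddedSummands ys zs t≥1 = record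
    { endsTwiceˡ = pad-endsTwice t ys (ℕP.m≤m⊔n _ _) t≥1
    ; endsTwiceʳ = pad-endsTwice t zs (ℕP.m≤n⊔m _ _) t≥1
    ; sameLength = ≡.trans (length-pad (suc t) ys (ℕP.m≤n⇒m≤1+n (ℕP.m≤m⊔n _ _)))
                     (≡.sym (length-pad (suc t) zs (ℕP.m≤n⇒m≤1+n (ℕP.m≤n⊔m _ _)))) }
    where t = addWidth ys zs

  lastOr-ADD : (ys zs : List C) → 1 ≤ addWidth ys zs →
    lastOr 𝟘 (ADD ys zs) ≡ topBit (lastOr 𝟘 ys) (lastOr 𝟘 zs) (addCarry ys zs)
  lastOr-ADD ys zs t≥1 = lastOr-addAux endsTwiceˡ endsTwiceʳ sameLength 𝟘 𝟘 𝟘 𝟘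
    where open PaddedSummands (paddedSummands ys zs t≥1)

  lastOr-map-addAux : ∀ {sy sz Y Z} → EndsTwice sy Y → EndsTwice sz Z →
    (f : C → C) (c d : C) → lastOr d (map f (addAux c Y Z)) ≡ f (lastOr d (addAux c Y Z))
  lastOr-map-addAux {Y = y ∷ Y} {Z = z ∷ Z} _ _ f c d = lastOr-map f _ (addAux _ Y Z)

  lastOr-map-ADD : (f : C → C) (ys zs : List C) → 1 ≤ addWidth ys zs →
    lastOr 𝟘 (map f (ADD ys zs)) ≡ f (lastOr 𝟘 (ADD ys zs))
  lastOr-map-ADD f ys zs t≥1 = lastOr-map-addAux endsTwiceˡ endsTwiceʳ f 𝟘 𝟘
    where open PaddedSummands (paddedSummands ys zs t≥1)

-- Cofactors, found by polynomial division, exhibiting topBit y z c in the ideal (y, z) and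
-- XOR (topBit s s c) s in the ideal (s² − s).
addTopCofactor₁ addTopCofactor₂ : Circ (Fin 3)
addTopCofactor₁ =
  const (+ 1) ⊕c c ⊕c const (ℤ.- + 1) ⊗c z ⊕c const (ℤ.- + 5) ⊗c z ⊗c c
  ⊕c const (ℤ.- + 2) ⊗c z ⊗c z ⊕c const (ℤ.- + 2) ⊗c y ⊗c c ⊕c const (ℤ.- + 2) ⊗c y ⊗c z
  ⊕c const (+ 5) ⊗c z ⊗c z ⊗c c ⊕c const (+ 5) ⊗c y ⊗c z ⊗c c ⊕c const (+ 4) ⊗c y ⊗c z ⊗c z
  ⊕c const (+ 2) ⊗c z ⊗c z ⊗c z ⊗c c ⊕c y ⊗c z ⊗c z ⊗c c ⊕c const (+ 2) ⊗c y ⊗c y ⊗c z ⊗c c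
  ⊕c const (ℤ.- + 6) ⊗c y ⊗c z ⊗c z ⊗c z ⊗c c ⊕c const (ℤ.- + 6) ⊗c y ⊗c y ⊗c z ⊗c z ⊗c c
  ⊕c const (+ 4) ⊗c y ⊗c y ⊗c z ⊗c z ⊗c z ⊗c c
  where
    y z c : Circ (Fin 3)
    y = var zero
    z = var (suc zero)
    c = var (suc (suc zero))
addTopCofactor₂ = const (+ 1) ⊕c c ⊕c const (ℤ.- + 2) ⊗c z ⊗c c
  where
    z c : Circ (Fin 3)
    z = var (suc zero)
    c = var (suc (suc zero))

absTopCofactor : Circ (Fin 2)
absTopCofactor =
  const (ℤ.- + 3) ⊕c const (ℤ.- + 2) ⊗c c ⊕c const (+ 2) ⊗c s ⊕c const (+ 11) ⊗c s ⊗c c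
  ⊕c const (+ 4) ⊗c s ⊗c s ⊕c const (ℤ.- + 17) ⊗c s ⊗c s ⊗c c ⊕c const (ℤ.- + 8) ⊗c s ⊗c s ⊗c s
  ⊕c const (ℤ.- + 2) ⊗c s ⊗c s ⊗c s ⊗c c ⊕c const (+ 20) ⊗c s ⊗c s ⊗c s ⊗c s ⊗c c
  ⊕c const (ℤ.- + 8) ⊗c s ⊗c s ⊗c s ⊗c s ⊗c s ⊗c c
  where
    s c : Circ (Fin 2)
    s = var zero
    c = var (suc zero)

module _ {V : Set} where

  private
    C = Circ V

  topBit≈cofactors : (y z c : C) →
    topBit y z c ≈ addTopCofactor₁ ⟪ lookup (y ∷ z ∷ c ∷ []) ⟫ ⊗c y
                   ⊕c addTopCofactor₂ ⟪ lookup (y ∷ z ∷ c ∷ []) ⟫ ⊗c z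
  topBit≈cofactors = solve 3 (λ y z c →
      XORᴾ (XORᴾ y z) (carryᴾ y z c)
    := addTopCofactor₁ ⟪ lookup (y ∷ z ∷ c ∷ []) ⟫ᴾ :* y :+ addTopCofactor₂ ⟪ lookup (y ∷ z ∷ c ∷ []) ⟫ᴾ :* z)
    ≈-refl
    where open CircuitRing V

  XOR-topBit≈cofactor : (s c : C) →
    XOR (topBit s s c) s ≈ absTopCofactor ⟪ lookup (s ∷ c ∷ []) ⟫ ⊗c boolAx s
  XOR-topBit≈cofactor = solve 2 (λ s c →
      XORᴾ (XORᴾ (XORᴾ s s) (carryᴾ s s c)) s := absTopCofactor ⟪ lookup (s ∷ c ∷ []) ⟫ᴾ :* boolAxᴾ s)
    ≈-refl
    where open CircuitRing V

  lastOr-ADD≈ : (ys zs : List C) →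
    lastOr 𝟘 (ADD ys zs) ≈ topBit (lastOr 𝟘 ys) (lastOr 𝟘 zs) (addCarry ys zs)
  lastOr-ADD≈ [] [] = solve 0 (XORᴾ (XORᴾ 0ᴾ 0ᴾ) 0ᴾ := XORᴾ (XORᴾ 0ᴾ 0ᴾ) (carryᴾ 0ᴾ 0ᴾ 0ᴾ)) ≈-refl
    where
      open CircuitRing V
      0ᴾ = con (+ 0)
  lastOr-ADD≈ [] (z ∷ zs) = ≡⇒≈ (lastOr-ADD [] (z ∷ zs) (s≤s z≤n))
    where open CircuitRing V
  lastOr-ADD≈ (y ∷ ys) zs = ≡⇒≈ (lastOr-ADD (y ∷ ys) zs (ℕP.≤-trans (s≤s z≤n) (ℕP.m≤m⊔n _ (length zs))))
    where open CircuitRing V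

  absCarry : List C → C
  absCarry xs = addCarry xs (replicate (length xs) (lastOr 𝟘 xs))

  lastOr-ABS≈ : (xs : List C) →
    lastOr 𝟘 (ABS xs) ≈ XOR (topBit (lastOr 𝟘 xs) (lastOr 𝟘 xs) (absCarry xs)) (lastOr 𝟘 xs)
  lastOr-ABS≈ [] =
    solve 0 (XORᴾ (XORᴾ (XORᴾ 0ᴾ 0ᴾ) 0ᴾ) 0ᴾ := XORᴾ (XORᴾ (XORᴾ 0ᴾ 0ᴾ) (carryᴾ 0ᴾ 0ᴾ 0ᴾ)) 0ᴾ) ≈-refl
    where
      open CircuitRing V
      0ᴾ = con (+ 0)
  lastOr-ABS≈ xs@(x ∷ xs′) = ≡⇒≈ (begin
    lastOr 𝟘 (map (λ e → XOR e s) (ADD xs rp))  ≡⟨ lastOr-map-ADD (λ e → XOR e s) xs rp (s≤s z≤n) ⟩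
    XOR (lastOr 𝟘 (ADD xs rp)) s              ≡⟨ ≡.cong (λ e → XOR e s) (lastOr-ADD xs rp (s≤s z≤n)) ⟩
    XOR (topBit s (lastOr s rp′) (absCarry xs)) s
      ≡⟨ ≡.cong (λ u → XOR (topBit s u (absCarry xs)) s) (lastOr-replicate s (length xs′)) ⟩
    XOR (topBit s s (absCarry xs)) s          ∎)
    where
      open ≡.≡-Reasoning
      open CircuitRing V using (≡⇒≈)
      s = lastOr 𝟘 xs
      rp = replicate (length xs) s
      rp′ = replicate (length xs′) s

  row : List C → ℕ → C → List C
  row as i b = replicate i 𝟘 ++ map (λ a → AND a b) as

  lastOr-row≈ : (as : List C) (i : ℕ) (b : C) → lastOr 𝟘 (row as i b) ≈ lastOr 𝟘 as ⊗c b
  lastOr-row≈ [] i b = ≈-trans (≡⇒≈ last≡𝟘) (≈-sym (⊗-zeroˡ b))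
    where
      open CircuitRing V using (≡⇒≈; ⊗-zeroˡ)
      last≡𝟘 : lastOr 𝟘 (replicate i 𝟘 ++ []) ≡ 𝟘
      last≡𝟘 = ≡.trans (≡.cong (lastOr 𝟘) (LP.++-identityʳ (replicate i 𝟘))) (lastOr-replicate 𝟘 i)
  lastOr-row≈ (a ∷ as) i b =
    ≡⇒≈ (≡.trans (lastOr-++-∷ 𝟘 (replicate i 𝟘) (AND a b) _) (lastOr-map (λ a → AND a b) a as))
    where open CircuitRing V using (≡⇒≈)

  XOR≈affine : (x s : C) → XOR x s ≈ xorSlope s ⊗c x ⊕c s
  XOR≈affine = solve 2 (λ x s → XORᴾ x s := xorSlopeᴾ s :* x :+ s) ≈-refl
    where open CircuitRing V

module ProdParts {V : Set} (ys zs : List (Circ V)) where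
  t : ℕ
  t = length ys ⊔ length zs
  ys′ zs′ A B P : List (Circ V)
  ys′ = pad t ys
  zs′ = pad t zs
  A = ABS ys′
  B = ABS zs′
  P = PROD⁺ A B
  s : Circ V
  s = XOR (lastOr 𝟘 ys′) (lastOr 𝟘 zs′)

-- Boolean IPS witnesses for the sign bit

module _ {n : ℕ} where

  private
    X = Fin n
    CX = Circ X
    CZ = Circ (Fin n ⊎ Fin n)

  open CircuitRing X using (≡⇒≈; ⊗-zeroˡ)

  embed : CX → CZ
  embed t = t ⟪ (λ j → var (inj₁ j)) ⟫

  embed-zeroSub : (t : CX) → embed t ⟪ zeroSub ⟫ ≡ t
  embed-zeroSub t = ≡.trans (⟪⟫-⟪⟫ t _ zeroSub) (⟪var⟫ t (λ _ → refl))

  embed-boolSub : (t : CX) → embed t ⟪ boolSub ⟫ ≡ t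
  embed-boolSub t = ≡.trans (⟪⟫-⟪⟫ t _ boolSub) (⟪var⟫ t (λ _ → refl))

  infix 4 _proves_
  record _proves_ (w : CZ) (t : CX) : Set where
    constructor _,_
    field
      vanishes : w ⟪ zeroSub ⟫ ≈ 𝟘
      specialises : w ⟪ boolSub ⟫ ≈ t

  proves⇒IsBoolIPSProof : ∀ {w t} → w proves t → IsBoolIPSProof w t
  proves⇒IsBoolIPSProof (w₀ , w₁) = w₀ , w₁

  proves-𝟘 : 𝟘 proves 𝟘
  proves-𝟘 = ≈-refl , ≈-refl

  proves-resp : ∀ {w t t′} → t ≈ t′ → w proves t → w proves t′
  proves-resp t≈t′ (w₀ , w₁) = w₀ , ≈-trans w₁ t≈t′

  proves-⊕ : ∀ {w w′ t t′} → w proves t → w′ proves t′ → w ⊕c w′ proves t ⊕c t′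
  proves-⊕ (w₀ , w₁) (w₀′ , w₁′) = ≈-trans (⊕-cong w₀ w₀′) (⊕-identityˡ 𝟘) , ⊕-cong w₁ w₁′

  proves-scale : ∀ {w t} (u : CX) → w proves t → embed u ⊗c w proves u ⊗c t
  proves-scale u (w₀ , w₁) =
    ≈-trans (⊗-cong (≡⇒≈ (embed-zeroSub u)) w₀) (≈-trans (⊗-comm u 𝟘) (⊗-zeroˡ u)) ,
    ⊗-cong (≡⇒≈ (embed-boolSub u)) w₁

  proves-axiom : (j : X) → var (inj₂ j) proves boolAx (var j)
  proves-axiom j = ≈-refl , ≈-refl

  data IsBool : CX → Set where
    var-bool : ∀ j → IsBool (var j)
    𝟘-bool : IsBool 𝟘
    𝟙-bool : IsBool 𝟙
    AND-bool : ∀ {a b} → IsBool a → IsBool b → IsBool (AND a b)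
    neg-bool : ∀ {a} → IsBool a → IsBool (neg a)
    XOR-bool : ∀ {a b} → IsBool a → IsBool b → IsBool (XOR a b)

  OR-bool : ∀ {a b} → IsBool a → IsBool b → IsBool (OR a b)
  OR-bool a b = neg-bool (AND-bool (neg-bool a) (neg-bool b))

  -- Defined on the syntax of t rather than on IsBool derivations, so that equal nodes get
  -- equal witnesses: this is what keeps the size of the final proof under control.
  boolWitness : CX → CZ
  boolWitness⊕ : CX → CX → CZ
  boolWitness (var j) = var (inj₂ j)
  boolWitness (const _) = 𝟘
  boolWitness (l ⊕c r) = boolWitness⊕ l r
  boolWitness (a ⊗c b) = embed (b ⊗c b) ⊗c boolWitness a ⊕c embed a ⊗c boolWitness b
  boolWitness⊕ (a ⊕c b) _ = boolWitness a ⊕c embed (xorCofactor a) ⊗c boolWitness b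
  boolWitness⊕ (const _) (_ ⊗c a) = boolWitness a
  boolWitness⊕ _ _ = 𝟘

  boolWitness-correct : ∀ {t} → IsBool t → boolWitness t proves boolAx t
  boolWitness-correct (var-bool j) = proves-axiom j
  boolWitness-correct 𝟘-bool = proves-resp (solve 0 (con (+ 0) := boolAxᴾ (con (+ 0))) ≈-refl) proves-𝟘
    where open CircuitRing X
  boolWitness-correct 𝟙-bool = proves-resp (solve 0 (con (+ 0) := boolAxᴾ (con (+ 1))) ≈-refl) proves-𝟘
    where open CircuitRing X
  boolWitness-correct (AND-bool {a} {b} p q) =
    proves-resp (solve 2 (λ a b → b :* b :* boolAxᴾ a :+ a :* boolAxᴾ b := boolAxᴾ (ANDᴾ a b)) ≈-refl a b)
      (proves-⊕ (proves-scale (b ⊗c b) (boolWitness-correct p)) (proves-scale a (boolWitness-correct q)))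
    where open CircuitRing X
  boolWitness-correct (neg-bool {a} p) =
    proves-resp (solve 1 (λ a → boolAxᴾ a := boolAxᴾ (negᴾ a)) ≈-refl a) (boolWitness-correct p)
    where open CircuitRing X
  boolWitness-correct (XOR-bool {a} {b} p q) =
    proves-resp (solve 2 (λ a b → boolAxᴾ a :+ xorCofactorᴾ a :* boolAxᴾ b := boolAxᴾ (XORᴾ a b)) ≈-refl a b)
      (proves-⊕ (boolWitness-correct p) (proves-scale (xorCofactor a) (boolWitness-correct q)))
    where open CircuitRing X

  addAux-bool : ∀ {c ys zs} → IsBool c → All IsBool ys → All IsBool zs → All IsBool (addAux c ys zs)
  addAux-bool c (y ∷ ys) (z ∷ zs) =
    XOR-bool (XOR-bool y z) c ∷ addAux-bool (OR-bool (AND-bool y z) (AND-bool (OR-bool y z) c)) ys zs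
  addAux-bool c [] _ = []
  addAux-bool c (_ ∷ _) [] = []

  ADD-bool : ∀ {ys zs} → All IsBool ys → All IsBool zs → All IsBool (ADD ys zs)
  ADD-bool ys zs = addAux-bool 𝟘-bool (All-pad _ 𝟘-bool ys) (All-pad _ 𝟘-bool zs)

  XOR-map-bool : ∀ {s es} → IsBool s → All IsBool es → All IsBool (map (λ e → XOR e s) es)
  XOR-map-bool s es = AllP.map⁺ (All.map (λ e → XOR-bool e s) es)

  ABS-bool : ∀ {xs} → All IsBool xs → All IsBool (ABS xs)
  ABS-bool {xs} bs = XOR-map-bool s (ADD-bool bs (AllP.replicate⁺ (length xs) s))
    where s = lastOr-All xs 𝟘-bool bs

  rows-bool : ∀ {as bs} i → All IsBool as → All IsBool bs → All (All IsBool) (rows as i bs)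
  rows-bool i as [] = []
  rows-bool i as (b ∷ bs) =
    AllP.++⁺ (AllP.replicate⁺ i 𝟘-bool) (AllP.map⁺ (All.map (λ a → AND-bool a b) as)) ∷ rows-bool (suc i) as bs

  sumRows-bool : ∀ {rs} → All (All IsBool) rs → All IsBool (sumRows rs)
  sumRows-bool [] = []
  sumRows-bool (r ∷ rs) = foldl-bool r rs
    where
      foldl-bool : ∀ {acc rs} → All IsBool acc → All (All IsBool) rs →
        All IsBool (foldl (λ acc r → ADD r acc) acc rs)
      foldl-bool acc [] = acc
      foldl-bool acc (r ∷ rs) = foldl-bool (ADD-bool r acc) rs

  PROD-bool : ∀ {ys zs} → All IsBool ys → All IsBool zs → All IsBool (PROD ys zs)
  PROD-bool {ys} {zs} bys bzs =
    ADD-bool (XOR-map-bool s (sumRows-bool (rows-bool 0 (ABS-bool bys′) (ABS-bool bzs′)))) (s ∷ 𝟘-bool ∷ [])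
    where
      t = length ys ⊔ length zs
      bys′ = All-pad t 𝟘-bool bys
      bzs′ = All-pad t 𝟘-bool bzs
      s = XOR-bool (lastOr-All (pad t ys) 𝟘-bool bys′) (lastOr-All (pad t zs) 𝟘-bool bzs′)

  digits-bool : ∀ k u → All IsBool (map (λ w → const (+ w)) (digits k u))
  digits-bool zero u = []
  digits-bool (suc k) u = bool-digit (u ℕD.% 2) (ℕD.m%n<n u 2) ∷ digits-bool k (u ℕD./ 2)
    where
      bool-digit : ∀ w → w < 2 → IsBool (const (+ w))
      bool-digit zero _ = 𝟘-bool
      bool-digit (suc zero) _ = 𝟙-bool
      bool-digit (suc (suc _)) (s≤s (s≤s ()))

  bit-bool : ∀ F → All IsBool (bit F)
  bit-bool (var j) = var-bool j ∷ 𝟘-bool ∷ []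
  bit-bool (const (+ m)) = digits-bool _ m
  bit-bool (const -[1+ m ]) = digits-bool _ _
  bit-bool (G ⊕c H) = ADD-bool (bit-bool G) (bit-bool H)
  bit-bool (G ⊗c H) = PROD-bool (bit-bool G) (bit-bool H)

  addEnv : List CX → List CX → Fin 3 → CX
  addEnv ys zs = lookup (lastOr 𝟘 ys ∷ lastOr 𝟘 zs ∷ addCarry ys zs ∷ [])

  addTopWitness : CZ → CZ → List CX → List CX → CZ
  addTopWitness wy wz ys zs =
    embed (addTopCofactor₁ ⟪ addEnv ys zs ⟫) ⊗c wy ⊕c embed (addTopCofactor₂ ⟪ addEnv ys zs ⟫) ⊗c wz

  addTopWitness-correct : ∀ {wy wz} ys zs → wy proves lastOr 𝟘 ys → wz proves lastOr 𝟘 zs →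
    addTopWitness wy wz ys zs proves lastOr 𝟘 (ADD ys zs)
  addTopWitness-correct ys zs py pz =
    proves-resp (≈-trans (≈-sym (topBit≈cofactors _ _ _)) (≈-sym (lastOr-ADD≈ ys zs)))
      (proves-⊕ (proves-scale _ py) (proves-scale _ pz))

  absEnv : List CX → Fin 2 → CX
  absEnv xs = lookup (lastOr 𝟘 xs ∷ absCarry xs ∷ [])

  absTopWitness : CZ → List CX → CZ
  absTopWitness wa xs = embed (absTopCofactor ⟪ absEnv xs ⟫) ⊗c wa

  absTopWitness-correct : ∀ {wa} xs → wa proves boolAx (lastOr 𝟘 xs) →
    absTopWitness wa xs proves lastOr 𝟘 (ABS xs)
  absTopWitness-correct xs pa =
    proves-resp (≈-trans (≈-sym (XOR-topBit≈cofactor _ _)) (≈-sym (lastOr-ABS≈ xs))) (proves-scale _ pa)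

  rowTopWitness-correct : ∀ {wA} as i b → wA proves lastOr 𝟘 as → embed b ⊗c wA proves lastOr 𝟘 (row as i b)
  rowTopWitness-correct as i b pA =
    proves-resp (≈-trans (⊗-comm _ _) (≈-sym (lastOr-row≈ as i b))) (proves-scale b pA)

  foldTopWitness : CZ → List CX → CZ → List CX → ℕ → List CX → CZ
  foldTopWitness wacc acc wA as i [] = wacc
  foldTopWitness wacc acc wA as i (b ∷ bs) =
    foldTopWitness (addTopWitness (embed b ⊗c wA) wacc (row as i b) acc) (ADD (row as i b) acc) wA as (suc i) bs

  foldTopWitness-correct : ∀ {wacc wA} acc as i bs → wacc proves lastOr 𝟘 acc → wA proves lastOr 𝟘 as →
    foldTopWitness wacc acc wA as i bs proves lastOr 𝟘 (foldl (λ acc r → ADD r acc) acc (rows as i bs))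
  foldTopWitness-correct acc as i [] pacc pA = pacc
  foldTopWitness-correct acc as i (b ∷ bs) pacc pA =
    foldTopWitness-correct (ADD (row as i b) acc) as (suc i) bs
      (addTopWitness-correct (row as i b) acc (rowTopWitness-correct as i b pA) pacc) pA

  prod⁺TopWitness : CZ → List CX → List CX → CZ
  prod⁺TopWitness wA as [] = 𝟘
  prod⁺TopWitness wA as (b ∷ bs) = foldTopWitness (embed b ⊗c wA) (row as 0 b) wA as 1 bs

  prod⁺TopWitness-correct : ∀ {wA} as bs → wA proves lastOr 𝟘 as →
    prod⁺TopWitness wA as bs proves lastOr 𝟘 (PROD⁺ as bs)
  prod⁺TopWitness-correct as [] pA = proves-𝟘
  prod⁺TopWitness-correct as (b ∷ bs) pA =
    foldTopWitness-correct (row as 0 b) as 1 bs (rowTopWitness-correct as 0 b pA) pA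

  xorMapTopWitness : CZ → CZ → CX → List CX → CZ
  xorMapTopWitness ws wP s [] = 𝟘
  xorMapTopWitness ws wP s (_ ∷ _) = embed (xorSlope s) ⊗c wP ⊕c ws

  xorMapTopWitness-correct : ∀ {ws wP} s ps → ws proves s → wP proves lastOr 𝟘 ps →
    xorMapTopWitness ws wP s ps proves lastOr 𝟘 (map (λ e → XOR e s) ps)
  xorMapTopWitness-correct s [] ps pP = proves-𝟘
  xorMapTopWitness-correct s (p ∷ ps) pS pP =
    proves-resp (≈-trans (≈-sym (XOR≈affine _ s)) (≡⇒≈ (≡.sym (lastOr-map (λ e → XOR e s) p ps))))
      (proves-⊕ (proves-scale _ pP) pS)

  module SquareSign (b : List CX) where
    open ProdParts b b public
    a : CX
    a = lastOr 𝟘 ys′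
    wa ws wA wP wX witness : CZ
    wa = boolWitness a
    ws = embed (const (ℤ.- + 2)) ⊗c wa
    wA = absTopWitness wa ys′
    wP = prod⁺TopWitness wA A A
    wX = xorMapTopWitness ws wP s P
    witness = addTopWitness wX 𝟘 (map (λ e → XOR e s) P) (s ∷ 𝟘 ∷ [])

  squareSignWitness-correct : ∀ b → All IsBool b → SquareSign.witness b proves lastOr 𝟘 (PROD b b)
  squareSignWitness-correct b bb =
    addTopWitness-correct (map (λ e → XOR e s) P) (s ∷ 𝟘 ∷ []) (xorMapTopWitness-correct s P ps pP) proves-𝟘
    where
      open SquareSign b
      open CircuitRing X using (solve; _:=_; _:*_; con; boolAxᴾ; XORᴾ)
      pa : wa proves boolAx a
      pa = boolWitness-correct (lastOr-All ys′ 𝟘-bool (All-pad _ 𝟘-bool bb))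
      ps : ws proves s
      ps = proves-resp (solve 1 (λ a → con (ℤ.- + 2) :* boolAxᴾ a := XORᴾ a a) ≈-refl a) (proves-scale _ pa)
      pP : wP proves lastOr 𝟘 P
      pP = prod⁺TopWitness-correct A A (absTopWitness-correct ys′ pa)

  -- On circuits rather than trees, so that equal subcircuits get equal witnesses; on toCirc T a
  -- product node is a leaf H ⊗ H.
  signWitness : CX → CZ
  signWitness (F ⊕c G) = addTopWitness (signWitness F) (signWitness G) (bit F) (bit G)
  signWitness (H ⊗c _) = SquareSign.witness (bit H)
  signWitness _ = 𝟘

  signWitness-correct : (T : SqTree X) → signWitness (toCirc T) proves signBit (toCirc T)
  signWitness-correct (leaf H) = squareSignWitness-correct (bit H) (bit-bool H)
  signWitness-correct (node T U) =
    addTopWitness-correct (bit (toCirc T)) (bit (toCirc U)) (signWitness-correct T) (signWitness-correct U)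

-- Nodes of the construction

module _ {V : Set} where

  private
    C = Circ V

  AllNodes : (C → Set) → C → Set
  AllNodes Q t@(var _) = Q t
  AllNodes Q t@(const _) = Q t
  AllNodes Q t@(a ⊕c b) = Q t × AllNodes Q a × AllNodes Q b
  AllNodes Q t@(a ⊗c b) = Q t × AllNodes Q a × AllNodes Q b

  AllNodes-map : ∀ {P Q : C → Set} → (∀ {u} → P u → Q u) → ∀ {t} → AllNodes P t → AllNodes Q t
  AllNodes-map f {var _} p = f p
  AllNodes-map f {const _} p = f p
  AllNodes-map f {a ⊕c b} (p , pa , pb) = f p , AllNodes-map f {a} pa , AllNodes-map f {b} pb
  AllNodes-map f {a ⊗c b} (p , pa , pb) = f p , AllNodes-map f {a} pa , AllNodes-map f {b} pb

  module _ (_≟_ : DecidableEquality V) {Q : C → Set} where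

    AllNodes⇒subterms : ∀ {t} → AllNodes Q t → ∀ {u} → u ∈ subterms _≟_ t → Q u
    AllNodes⇒subterms {var _} q (here refl) = q
    AllNodes⇒subterms {const _} q (here refl) = q
    AllNodes⇒subterms {a ⊕c b} (q , qa , qb) (here refl) = q
    AllNodes⇒subterms {a ⊕c b} (q , qa , qb) (there u∈) =
      [ AllNodes⇒subterms qa , AllNodes⇒subterms qb ]′ (∈-++⁻ (subterms _≟_ a) u∈)
    AllNodes⇒subterms {a ⊗c b} (q , qa , qb) (here refl) = q
    AllNodes⇒subterms {a ⊗c b} (q , qa , qb) (there u∈) =
      [ AllNodes⇒subterms qa , AllNodes⇒subterms qb ]′ (∈-++⁻ (subterms _≟_ a) u∈)

    subterms⇒AllNodes : ∀ t → (∀ {u} → u ∈ subterms _≟_ t → Q u) → AllNodes Q t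
    subterms⇒AllNodes (var _) h = h (here refl)
    subterms⇒AllNodes (const _) h = h (here refl)
    subterms⇒AllNodes (a ⊕c b) h =
      h (here refl) , subterms⇒AllNodes a (h ∘ there ∘ ∈-++⁺ˡ) , subterms⇒AllNodes b (h ∘ there ∘ ∈-++⁺ʳ _)
    subterms⇒AllNodes (a ⊗c b) h =
      h (here refl) , subterms⇒AllNodes a (h ∘ there ∘ ∈-++⁺ˡ) , subterms⇒AllNodes b (h ∘ there ∘ ∈-++⁺ʳ _)

AllNodes-⟪⟫ : ∀ {V W} {Q : Circ W → Set} {ρ : V → Circ W} (t : Circ V) →
  (∀ v → Q (ρ v) → AllNodes Q (ρ v)) → AllNodes (λ u → Q (u ⟪ ρ ⟫)) t → AllNodes Q (t ⟪ ρ ⟫)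
AllNodes-⟪⟫ (var v) hρ q = hρ v q
AllNodes-⟪⟫ (const _) hρ q = q
AllNodes-⟪⟫ (a ⊕c b) hρ (q , qa , qb) = q , AllNodes-⟪⟫ a hρ qa , AllNodes-⟪⟫ b hρ qb
AllNodes-⟪⟫ (a ⊗c b) hρ (q , qa , qb) = q , AllNodes-⟪⟫ a hρ qa , AllNodes-⟪⟫ b hρ qb

nodeCount : ∀ {k} → Circ (Fin k) → ℕ
nodeCount T = length (subterms FinP._≟_ T)

instanceNodes : ∀ {V k} → Circ (Fin k) → Vec (Circ V) k → List (Circ V)
instanceNodes T vs = map (_⟪ lookup vs ⟫) (subterms FinP._≟_ T)

AllNodes-instance : ∀ {V k} {Q : Circ V → Set} (T : Circ (Fin k)) {vs : Vec (Circ V) k} →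
  VAll.All (AllNodes Q) vs → All Q (instanceNodes T vs) → AllNodes Q (T ⟪ lookup vs ⟫)
AllNodes-instance T nvs q =
  AllNodes-⟪⟫ T (λ i _ → VAllP.lookup⁺ nvs i)
    (subterms⇒AllNodes FinP._≟_ T (All.lookup (AllP.map⁻ q)))

-- The gates as templates: XOR a b is definitionally XORᵗ ⟪ lookup (a ∷ b ∷ []) ⟫, and so on.
ANDᵗ XORᵗ : Circ (Fin 2)
ANDᵗ = AND (var zero) (var (suc zero))
XORᵗ = XOR (var zero) (var (suc zero))

sumBitᵗ carryᵗ : Circ (Fin 3)
sumBitᵗ = XOR (XOR (var zero) (var (suc zero))) (var (suc (suc zero)))
carryᵗ = carry (var zero) (var (suc zero)) (var (suc (suc zero)))

module _ {V : Set} where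

  private
    C = Circ V

  -- Each construction is paired with the list of nodes it creates on top of those of its inputs.
  addAuxNodes : C → List C → List C → List C
  addAuxNodes c (y ∷ ys) (z ∷ zs) =
    instanceNodes sumBitᵗ (y ∷ z ∷ c ∷ []) ++ instanceNodes carryᵗ (y ∷ z ∷ c ∷ [])
    ++ addAuxNodes (carry y z c) ys zs
  addAuxNodes c _ _ = []

  ADDNodes : List C → List C → List C
  ADDNodes ys zs = addAuxNodes 𝟘 (pad (suc t) ys) (pad (suc t) zs)
    where t = addWidth ys zs

  xorMapNodes : C → List C → List C
  xorMapNodes s = concatMap (λ e → instanceNodes XORᵗ (e ∷ s ∷ []))

  ABSNodes : List C → List C
  ABSNodes xs = ADDNodes xs rp ++ xorMapNodes s (ADD xs rp)
    where
      s = lastOr 𝟘 xs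
      rp = replicate (length xs) s

  rowNodes : List C → C → List C
  rowNodes as b = concatMap (λ a → instanceNodes ANDᵗ (a ∷ b ∷ [])) as

  foldNodes : List C → List C → ℕ → List C → List C
  foldNodes acc as i [] = []
  foldNodes acc as i (b ∷ bs) =
    rowNodes as b ++ ADDNodes (row as i b) acc ++ foldNodes (ADD (row as i b) acc) as (suc i) bs

  PROD⁺Nodes : List C → List C → List C
  PROD⁺Nodes as [] = []
  PROD⁺Nodes as (b ∷ bs) = rowNodes as b ++ foldNodes (row as 0 b) as 1 bs

  PRODNodeParts : List C → List C → List (List C)
  PRODNodeParts ys zs =
    ( instanceNodes XORᵗ (lastOr 𝟘 ys′ ∷ lastOr 𝟘 zs′ ∷ [])
    ∷ ABSNodes ys′ ∷ ABSNodes zs′ ∷ PROD⁺Nodes A B ∷ xorMapNodes s P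
    ∷ ADDNodes (map (λ e → XOR e s) P) (s ∷ 𝟘 ∷ []) ∷ [])
    where open ProdParts ys zs

  PRODNodes : List C → List C → List C
  PRODNodes ys zs = concat (PRODNodeParts ys zs)

  bitNodes : C → List C
  bitNodes (var j) = var j ∷ 𝟘 ∷ []
  bitNodes (const α) = bit (const α)
  bitNodes (F ⊕c G) = ADDNodes (bit F) (bit G)
  bitNodes (F ⊗c G) = PRODNodes (bit F) (bit G)

module BitNodeCoverage {V : Set} (Q : Circ V → Set) (Q𝟘 : Q 𝟘) where

  private
    C = Circ V
    N = AllNodes Q

  addAux-nodes : ∀ {c ys zs} → N c → All N ys → All N zs → All Q (addAuxNodes c ys zs) →
    All N (addAux c ys zs)
  addAux-nodes {c} {y ∷ ys} {z ∷ zs} nc (ny ∷ nys) (nz ∷ nzs) q =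
    AllNodes-instance sumBitᵗ {vs} nvs (AllP.++⁻ˡ sumNodes q)
    ∷ addAux-nodes (AllNodes-instance carryᵗ {vs} nvs (AllP.++⁻ˡ carryNodes q′)) nys nzs
        (AllP.++⁻ʳ carryNodes q′)
    where
      vs = y ∷ z ∷ c ∷ []
      nvs = ny VAll.∷ nz VAll.∷ nc VAll.∷ VAll.[]
      sumNodes = instanceNodes sumBitᵗ vs
      carryNodes = instanceNodes carryᵗ vs
      q′ = AllP.++⁻ʳ sumNodes q
  addAux-nodes {ys = []} _ _ _ _ = []
  addAux-nodes {ys = _ ∷ _} {[]} _ _ _ _ = []

  ADD-nodes : ∀ {ys zs} → All N ys → All N zs → All Q (ADDNodes ys zs) → All N (ADD ys zs)
  ADD-nodes nys nzs = addAux-nodes Q𝟘 (All-pad _ Q𝟘 nys) (All-pad _ Q𝟘 nzs)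

  -- The penultimate carry is not an entry of the output, but it is a node of the last output bit.
  topBit-nodes⁻ : ∀ {y z c} → N (topBit y z c) → N c
  topBit-nodes⁻ (_ , (_ , _ , (_ , _ , (_ , _ , (_ , _ , (_ , _ , (_ , _ , (_ , _ , nc))))))) , _) = nc

  last-nodes : ∀ {xs} → All N xs → N (lastOr 𝟘 xs)
  last-nodes {xs} = lastOr-All {d = 𝟘} xs Q𝟘

  addCarry-nodes-wide : ∀ ys zs → 1 ≤ addWidth ys zs → All N (ADD ys zs) → N (addCarry ys zs)
  addCarry-nodes-wide ys zs t≥1 n =
    topBit-nodes⁻ (≡.subst N (lastOr-ADD ys zs t≥1) (last-nodes n))

  addCarry-nodes : ∀ ys zs → All N (ADD ys zs) → N (addCarry ys zs)
  addCarry-nodes [] [] _ = Q𝟘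
  addCarry-nodes [] zs@(_ ∷ _) = addCarry-nodes-wide [] zs (s≤s z≤n)
  addCarry-nodes ys@(_ ∷ _) zs = addCarry-nodes-wide ys zs (ℕP.≤-trans (s≤s z≤n) (ℕP.m≤m⊔n _ (length zs)))

  xorMap-nodes : ∀ {s es} → N s → All N es → All Q (xorMapNodes s es) → All N (map (λ e → XOR e s) es)
  xorMap-nodes ns [] q = []
  xorMap-nodes {s} {e ∷ es} ns (ne ∷ nes) q =
    AllNodes-instance XORᵗ (ne VAll.∷ ns VAll.∷ VAll.[]) (AllP.++⁻ˡ eNodes q)
    ∷ xorMap-nodes ns nes (AllP.++⁻ʳ eNodes q)
    where eNodes = instanceNodes XORᵗ (e ∷ s ∷ [])

  ABS-nodes : ∀ {xs} → All N xs → All Q (ABSNodes xs) → All N (ABS xs)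
  ABS-nodes {xs} nxs q =
    xorMap-nodes ns (ADD-nodes nxs (AllP.replicate⁺ (length xs) ns) (AllP.++⁻ˡ (ADDNodes xs rp) q))
      (AllP.++⁻ʳ (ADDNodes xs rp) q)
    where
      ns = last-nodes nxs
      rp = replicate (length xs) (lastOr 𝟘 xs)

  row-nodes : ∀ {as b} i → All N as → N b → All Q (rowNodes as b) → All N (row as i b)
  row-nodes {b = b} i nas nb q = AllP.++⁺ (AllP.replicate⁺ i Q𝟘) (ANDs nas q)
    where
      ANDs : ∀ {as} → All N as → All Q (rowNodes as b) → All N (map (λ a → AND a b) as)
      ANDs [] q = []
      ANDs {a ∷ as} (na ∷ nas) q =
        AllNodes-instance ANDᵗ (na VAll.∷ nb VAll.∷ VAll.[]) (AllP.++⁻ˡ (instanceNodes ANDᵗ (a ∷ b ∷ [])) q)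
        ∷ ANDs nas (AllP.++⁻ʳ (instanceNodes ANDᵗ (a ∷ b ∷ [])) q)

  fold-nodes : ∀ {acc as} i {bs} → All N acc → All N as → All N bs → All Q (foldNodes acc as i bs) →
    All N (foldl (λ acc r → ADD r acc) acc (rows as i bs))
  fold-nodes i nacc nas [] q = nacc
  fold-nodes {acc} {as} i {b ∷ bs} nacc nas (nb ∷ nbs) q =
    fold-nodes (suc i) (ADD-nodes nrow nacc (AllP.++⁻ˡ addNodes q′)) nas nbs (AllP.++⁻ʳ addNodes q′)
    where
      nrow = row-nodes i nas nb (AllP.++⁻ˡ (rowNodes as b) q)
      q′ = AllP.++⁻ʳ (rowNodes as b) q
      addNodes = ADDNodes (row as i b) acc

  PROD⁺-nodes : ∀ {as bs} → All N as → All N bs → All Q (PROD⁺Nodes as bs) → All N (PROD⁺ as bs)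
  PROD⁺-nodes nas [] q = []
  PROD⁺-nodes {as} {b ∷ bs} nas (nb ∷ nbs) q =
    fold-nodes 1 (row-nodes 0 nas nb (AllP.++⁻ˡ (rowNodes as b) q)) nas nbs (AllP.++⁻ʳ (rowNodes as b) q)

  PROD-nodes : ∀ {ys zs} → All N ys → All N zs → All Q (PRODNodes ys zs) → All N (PROD ys zs)
  PROD-nodes {ys} {zs} nys nzs q with AllP.concat⁻ {xss = PRODNodeParts ys zs} q
  ... | q₁ ∷ q₂ ∷ q₃ ∷ q₄ ∷ q₅ ∷ q₆ ∷ [] = ADD-nodes (xorMap-nodes ns nP q₅) (ns ∷ Q𝟘 ∷ []) q₆
    where
      open ProdParts ys zs
      nys′ = All-pad t Q𝟘 nys
      nzs′ = All-pad t Q𝟘 nzs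
      ns = AllNodes-instance XORᵗ {lastOr 𝟘 ys′ ∷ lastOr 𝟘 zs′ ∷ []}
             (last-nodes nys′ VAll.∷ last-nodes nzs′ VAll.∷ VAll.[]) q₁
      nP = PROD⁺-nodes (ABS-nodes nys′ q₂) (ABS-nodes nzs′ q₃) q₄

  digits-nodes : ∀ ds → All Q (map (λ w → const (+ w)) ds) → All N (map (λ w → const (+ w)) ds)
  digits-nodes [] q = []
  digits-nodes (d ∷ ds) (q ∷ qs) = q ∷ digits-nodes ds qs

  bit-nodes : ∀ F → AllNodes (λ G → All Q (bitNodes G)) F → All N (bit F)
  bit-nodes (var j) (q ∷ q𝟘 ∷ []) = q ∷ q𝟘 ∷ []
  bit-nodes (const (+ m)) q = digits-nodes _ q
  bit-nodes (const -[1+ m ]) q = digits-nodes _ q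
  bit-nodes (F ⊕c G) (q , qF , qG) = ADD-nodes (bit-nodes F qF) (bit-nodes G qG) q
  bit-nodes (F ⊗c G) (q , qF , qG) = PROD-nodes (bit-nodes F qF) (bit-nodes G qG) q

xorCofactorᵗ xorSlopeᵗ : Circ (Fin 1)
xorCofactorᵗ = xorCofactor (var zero)
xorSlopeᵗ = xorSlope (var zero)

module _ {n : ℕ} where

  private
    CX = Circ (Fin n)
    CZ = Circ (Fin n ⊎ Fin n)

  embedInstanceNodes : ∀ {k} → Circ (Fin k) → Vec CX k → List CZ
  embedInstanceNodes T vs = map embed (instanceNodes T vs)

  xorWitnessNodes : CX → CX → List CZ
  xorWitnessNodes (a ⊕c b) r =
    boolWitness (a ⊕c b ⊕c r) ∷ embed (xorCofactor a) ⊗c boolWitness b ∷ embedInstanceNodes xorCofactorᵗ (a ∷ [])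
  xorWitnessNodes _ _ = []

  boolWitnessNodes : CX → List CZ
  boolWitnessNodes (var j) = var (inj₂ j) ∷ []
  boolWitnessNodes (const _) = []
  boolWitnessNodes (l ⊕c r) = xorWitnessNodes l r
  boolWitnessNodes t@(a ⊗c b) =
    boolWitness t ∷ embed (b ⊗c b) ⊗c boolWitness a ∷ embed (b ⊗c b) ∷ embed a ⊗c boolWitness b ∷ []

  addTopWitnessNodes : CZ → CZ → List CX → List CX → List CZ
  addTopWitnessNodes wy wz ys zs =
    addTopWitness wy wz ys zs
    ∷ embed (addTopCofactor₁ ⟪ addEnv ys zs ⟫) ⊗c wy ∷ embed (addTopCofactor₂ ⟪ addEnv ys zs ⟫) ⊗c wz
    ∷ embedInstanceNodes addTopCofactor₁ env ++ embedInstanceNodes addTopCofactor₂ env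
    where env = lastOr 𝟘 ys ∷ lastOr 𝟘 zs ∷ addCarry ys zs ∷ []

  absTopWitnessNodes : CZ → List CX → List CZ
  absTopWitnessNodes wa xs =
    absTopWitness wa xs ∷ embedInstanceNodes absTopCofactor (lastOr 𝟘 xs ∷ absCarry xs ∷ [])

  foldTopWitnessNodes : CZ → List CX → CZ → List CX → ℕ → List CX → List CZ
  foldTopWitnessNodes wacc acc wA as i [] = []
  foldTopWitnessNodes wacc acc wA as i (b ∷ bs) =
    embed b ⊗c wA ∷ addTopWitnessNodes (embed b ⊗c wA) wacc (row as i b) acc
    ++ foldTopWitnessNodes (addTopWitness (embed b ⊗c wA) wacc (row as i b) acc) (ADD (row as i b) acc)
         wA as (suc i) bs

  prod⁺TopWitnessNodes : CZ → List CX → List CX → List CZ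
  prod⁺TopWitnessNodes wA as [] = []
  prod⁺TopWitnessNodes wA as (b ∷ bs) = embed b ⊗c wA ∷ foldTopWitnessNodes (embed b ⊗c wA) (row as 0 b) wA as 1 bs

  xorMapTopWitnessNodes : CZ → CZ → CX → List CX → List CZ
  xorMapTopWitnessNodes ws wP s [] = []
  xorMapTopWitnessNodes ws wP s ps@(_ ∷ _) =
    xorMapTopWitness ws wP s ps ∷ embed (xorSlope s) ⊗c wP ∷ embedInstanceNodes xorSlopeᵗ (s ∷ [])

  squareSignWitnessNodeParts : List CX → List (List CZ)
  squareSignWitnessNodeParts b =
    addTopWitnessNodes wX 𝟘 (map (λ e → XOR e s) P) (s ∷ 𝟘 ∷ [])
    ∷ xorMapTopWitnessNodes ws wP s P ∷ (ws ∷ embed (const (ℤ.- + 2)) ∷ [])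
    ∷ absTopWitnessNodes wa ys′ ∷ prod⁺TopWitnessNodes wA A A ∷ []
    where open SquareSign b

  signWitnessNodes : CX → List CZ
  signWitnessNodes (F ⊕c G) = addTopWitnessNodes (signWitness F) (signWitness G) (bit F) (bit G)
  signWitnessNodes (H ⊗c _) = concat (squareSignWitnessNodeParts (bit H))
  signWitnessNodes _ = []

module WitnessNodeCoverage {n : ℕ} (QX : Circ (Fin n) → Set) (QX𝟘 : QX 𝟘)
  (Q : Circ (Fin n ⊎ Fin n) → Set) (Q-embed : ∀ {u} → QX u → Q (embed u))
  (Q-bool : ∀ {u} → QX u → All Q (boolWitnessNodes u)) where

  open BitNodeCoverage QX QX𝟘

  private
    NX = AllNodes QX
    N = AllNodes Q
    Q𝟘 : Q 𝟘
    Q𝟘 = Q-embed QX𝟘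

  AllNodes-embed : ∀ {u} → AllNodes (Q ∘ embed) u → N (embed u)
  AllNodes-embed {u} = AllNodes-⟪⟫ u (λ _ q → q)

  embed-nodes : ∀ {u} → NX u → N (embed u)
  embed-nodes {u} nu = AllNodes-embed {u} (AllNodes-map Q-embed {u} nu)

  embedInstance-nodes : ∀ {k} (T : Circ (Fin k)) {vs} → VAll.All NX vs →
    All Q (embedInstanceNodes T vs) → N (embed (T ⟪ lookup vs ⟫))
  embedInstance-nodes T {vs} nvs q =
    AllNodes-embed {T ⟪ lookup vs ⟫}
      (AllNodes-instance T {vs} (VAll.map (λ {x} → AllNodes-map Q-embed {x}) nvs) (AllP.map⁻ q))

  boolWitness-nodes : ∀ {t} → IsBool t → NX t → N (boolWitness t)
  boolWitness-nodes (var-bool j) q with Q-bool q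
  ... | w ∷ [] = w
  boolWitness-nodes 𝟘-bool _ = Q𝟘
  boolWitness-nodes 𝟙-bool _ = Q𝟘
  boolWitness-nodes (AND-bool {a} {b} p p′) (q , na , nb) with Q-bool q
  ... | w₀ ∷ w₁ ∷ w₂ ∷ w₃ ∷ [] =
    w₀ , (w₁ , (w₂ , eb , eb) , boolWitness-nodes p na) , (w₃ , embed-nodes {a} na , boolWitness-nodes p′ nb)
    where eb = embed-nodes {b} nb
  boolWitness-nodes (neg-bool p) (_ , _ , (_ , _ , na)) = boolWitness-nodes p na
  boolWitness-nodes (XOR-bool {a} p p′) (q , (_ , na , nb) , _) with Q-bool q
  ... | w₀ ∷ w₁ ∷ ws =
    w₀ , boolWitness-nodes p na
       , (w₁ , embedInstance-nodes xorCofactorᵗ {a ∷ []} (na VAll.∷ VAll.[]) ws , boolWitness-nodes p′ nb)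

  addTopWitness-nodes : ∀ wy wz ys zs → All NX ys → All NX zs → All NX (ADD ys zs) → N wy → N wz →
    All Q (addTopWitnessNodes wy wz ys zs) → N (addTopWitness wy wz ys zs)
  addTopWitness-nodes wy wz ys zs nys nzs nsum nwy nwz (q₀ ∷ q₁ ∷ q₂ ∷ qs) =
    q₀ , (q₁ , embedInstance-nodes addTopCofactor₁ {vs} env (AllP.++⁻ˡ nodes₁ qs) , nwy)
       , (q₂ , embedInstance-nodes addTopCofactor₂ {vs} env (AllP.++⁻ʳ nodes₁ qs) , nwz)
    where
      vs = lastOr 𝟘 ys ∷ lastOr 𝟘 zs ∷ addCarry ys zs ∷ []
      env : VAll.All NX vs
      env = last-nodes nys VAll.∷ last-nodes nzs VAll.∷ addCarry-nodes ys zs nsum VAll.∷ VAll.[]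
      nodes₁ = embedInstanceNodes addTopCofactor₁ vs

  absTopWitness-nodes : ∀ wa xs → All NX xs → All NX (ADD xs (replicate (length xs) (lastOr 𝟘 xs))) →
    N wa → All Q (absTopWitnessNodes wa xs) → N (absTopWitness wa xs)
  absTopWitness-nodes wa xs nxs nsum nwa (q₀ ∷ qs) =
    q₀ , embedInstance-nodes absTopCofactor {lastOr 𝟘 xs ∷ absCarry xs ∷ []}
           (last-nodes nxs VAll.∷ addCarry-nodes xs (replicate (length xs) (lastOr 𝟘 xs)) nsum VAll.∷ VAll.[]) qs
       , nwa

  foldTopWitness-nodes : ∀ wacc acc wA as i bs → All NX acc → All NX as → All NX bs →
    All QX (foldNodes acc as i bs) → N wacc → N wA → All Q (foldTopWitnessNodes wacc acc wA as i bs) →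
    N (foldTopWitness wacc acc wA as i bs)
  foldTopWitness-nodes wacc acc wA as i [] _ _ _ _ nwacc _ _ = nwacc
  foldTopWitness-nodes wacc acc wA as i (b ∷ bs) nacc nas (nb ∷ nbs) qX nwacc nwA (q₀ ∷ qs) =
    foldTopWitness-nodes wnext (ADD (row as i b) acc) wA as (suc i) bs nsum nas nbs (AllP.++⁻ʳ addNodes qX′)
      nnext nwA (AllP.++⁻ʳ stepNodes qs)
    where
      nrow = row-nodes i nas nb (AllP.++⁻ˡ (rowNodes as b) qX)
      qX′ = AllP.++⁻ʳ (rowNodes as b) qX
      addNodes = ADDNodes (row as i b) acc
      nsum = ADD-nodes nrow nacc (AllP.++⁻ˡ addNodes qX′)
      wnext = addTopWitness (embed b ⊗c wA) wacc (row as i b) acc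
      stepNodes = addTopWitnessNodes (embed b ⊗c wA) wacc (row as i b) acc
      nnext = addTopWitness-nodes (embed b ⊗c wA) wacc (row as i b) acc nrow nacc nsum
                (q₀ , embed-nodes {b} nb , nwA) nwacc (AllP.++⁻ˡ stepNodes qs)

  prod⁺TopWitness-nodes : ∀ wA as bs → All NX as → All NX bs → All QX (PROD⁺Nodes as bs) → N wA →
    All Q (prod⁺TopWitnessNodes wA as bs) → N (prod⁺TopWitness wA as bs)
  prod⁺TopWitness-nodes wA as [] _ _ _ _ _ = Q𝟘
  prod⁺TopWitness-nodes wA as (b ∷ bs) nas (nb ∷ nbs) qX nwA (q₀ ∷ qs) =
    foldTopWitness-nodes (embed b ⊗c wA) (row as 0 b) wA as 1 bs
      (row-nodes 0 nas nb (AllP.++⁻ˡ (rowNodes as b) qX)) nas nbs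
      (AllP.++⁻ʳ (rowNodes as b) qX) (q₀ , embed-nodes {b} nb , nwA) nwA qs

  xorMapTopWitness-nodes : ∀ ws wP s ps → NX s → N ws → N wP →
    All Q (xorMapTopWitnessNodes ws wP s ps) → N (xorMapTopWitness ws wP s ps)
  xorMapTopWitness-nodes ws wP s [] _ _ _ _ = Q𝟘
  xorMapTopWitness-nodes ws wP s (_ ∷ _) ns nws nwP (q₀ ∷ q₁ ∷ qs) =
    q₀ , (q₁ , embedInstance-nodes xorSlopeᵗ {s ∷ []} (ns VAll.∷ VAll.[]) qs , nwP) , nws

  squareSignWitness-nodes : ∀ b → All IsBool b → All NX b → All (All QX) (PRODNodeParts b b) →
    All (All Q) (squareSignWitnessNodeParts b) → N (SquareSign.witness b)
  squareSignWitness-nodes b bb nb (qX₁ ∷ qX₂ ∷ _ ∷ qX₄ ∷ qX₅ ∷ qX₆ ∷ [])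
                                  (q₁ ∷ q₂ ∷ (qws ∷ q₋₂ ∷ []) ∷ q₄ ∷ q₅ ∷ []) =
    addTopWitness-nodes wX 𝟘 (map (λ e → XOR e s) P) (s ∷ 𝟘 ∷ []) nxs nlast nsum nwX Q𝟘 q₁
    where
      open SquareSign b
      nys′ : All NX ys′
      nys′ = All-pad _ QX𝟘 nb
      na : NX a
      na = last-nodes nys′
      ns : NX s
      ns = AllNodes-instance XORᵗ {a ∷ a ∷ []} (na VAll.∷ na VAll.∷ VAll.[]) qX₁
      nlast : All NX (s ∷ 𝟘 ∷ [])
      nlast = ns ∷ QX𝟘 ∷ []
      nA : All NX A
      nA = ABS-nodes nys′ qX₂
      nxs : All NX (map (λ e → XOR e s) P)
      nxs = xorMap-nodes ns (PROD⁺-nodes nA nA qX₄) qX₅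
      nsum : All NX (ADD (map (λ e → XOR e s) P) (s ∷ 𝟘 ∷ []))
      nsum = ADD-nodes nxs nlast qX₆
      rp : List (Circ (Fin n))
      rp = replicate (length ys′) a
      nwa : N wa
      nwa = boolWitness-nodes (lastOr-All ys′ 𝟘-bool (All-pad _ 𝟘-bool bb)) na
      nwA : N wA
      nwA = absTopWitness-nodes wa ys′ nys′
              (ADD-nodes nys′ (AllP.replicate⁺ (length ys′) na) (AllP.++⁻ˡ (ADDNodes ys′ rp) qX₂)) nwa q₄
      nwX : N wX
      nwX = xorMapTopWitness-nodes ws wP s P ns (qws , q₋₂ , nwa)
              (prod⁺TopWitness-nodes wA A A nA nA qX₄ nwA q₅) q₂

  signWitness-nodes : (T : SqTree (Fin n)) → AllNodes (λ G → All QX (bitNodes G)) (toCirc T) →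
    AllNodes (λ G → All Q (signWitnessNodes G)) (toCirc T) → N (signWitness (toCirc T))
  signWitness-nodes (leaf H) (qX , qXH , _) (q , _ , _) =
    squareSignWitness-nodes (bit H) (bit-bool H) (bit-nodes H qXH)
      (AllP.concat⁻ {xss = PRODNodeParts (bit H) (bit H)} qX)
      (AllP.concat⁻ {xss = squareSignWitnessNodeParts (bit H)} q)
  signWitness-nodes (node T U) (qX , qXT , qXU) (q , qT , qU) =
    addTopWitness-nodes (signWitness F) (signWitness G) (bit F) (bit G) nF nG (ADD-nodes nF nG qX)
      (signWitness-nodes T qXT qT) (signWitness-nodes U qXU qU) q
    where
      F = toCirc T
      G = toCirc U
      nF = bit-nodes F qXT
      nG = bit-nodes G qXU

-- Counting the nodes

length-++-≤ : ∀ {A : Set} (xs ys : List A) {m n} → length xs ≤ m → length ys ≤ n → length (xs ++ ys) ≤ m + n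
length-++-≤ xs ys p q = ℕP.≤-trans (ℕP.≤-reflexive (LP.length-++ xs)) (ℕP.+-mono-≤ p q)

length-concat-≤ : ∀ {A : Set} {xss : List (List A)} {ms} → Pointwise (λ xs m → length xs ≤ m) xss ms →
  length (concat xss) ≤ sum ms
length-concat-≤ [] = z≤n
length-concat-≤ {xss = xs ∷ xss} (p ∷ ps) = length-++-≤ xs (concat xss) p (length-concat-≤ ps)

length-concatMap-≤ : ∀ {A B : Set} (f : A → List B) {k} (xs : List A) →
  (∀ {x} → x ∈ xs → length (f x) ≤ k) → length (concatMap f xs) ≤ length xs * k
length-concatMap-≤ f [] h = z≤n
length-concatMap-≤ f (x ∷ xs) h =
  length-++-≤ (f x) (concatMap f xs) (h (here refl)) (length-concatMap-≤ f xs (h ∘ there))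

∉-++-∷ : ∀ {A : Set} {x y : A} (ys₁ ys₂ : List A) → y ∈ ys₁ ++ x ∷ ys₂ → x ≢ y → y ∈ ys₁ ++ ys₂
∉-++-∷ ys₁ ys₂ y∈ x≢y with ∈-++⁻ ys₁ y∈
... | inj₁ y∈ys₁ = ∈-++⁺ˡ y∈ys₁
... | inj₂ (here refl) = ⊥-elim (x≢y refl)
... | inj₂ (there y∈ys₂) = ∈-++⁺ʳ ys₁ y∈ys₂

Unique⇒length≤ : ∀ {A : Set} {xs ys : List A} → Unique xs → (∀ {x} → x ∈ xs → x ∈ ys) → length xs ≤ length ys
Unique⇒length≤ {xs = []} _ _ = z≤n
Unique⇒length≤ {xs = x ∷ xs} (x∉xs ∷ u) xs⊆ys with ∈-∃++ (xs⊆ys (here refl))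
... | ys₁ , ys₂ , refl =
  ℕP.≤-trans (s≤s (Unique⇒length≤ u (λ y∈ → ∉-++-∷ ys₁ ys₂ (xs⊆ys (there y∈)) (All.lookup x∉xs y∈))))
    (ℕP.≤-reflexive (≡.sym (LP.length-++-sucʳ ys₁ x ys₂)))

All-∈-concatMap : ∀ {A B : Set} (f : A → List B) {x xs} → x ∈ xs → All (_∈ concatMap f xs) (f x)
All-∈-concatMap f x∈ = All.tabulate (λ y∈ → ∈-concatMap⁺ f (Any.map (λ x≡ → ≡.subst (λ z → _ ∈ f z) x≡ y∈) x∈))

+-suc-shift : ∀ a b c → a + suc b + c ≡ a + b + suc c
+-suc-shift = ℕS.solve 3 (λ a b c → a :+ (con 1 :+ b) :+ c := a :+ b :+ (con 1 :+ c)) refl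
  where open ℕS

-- Node budgets: κstep per full-adder step, κxor and κand per gate, κprod per (1 + width)² for
-- PROD, κbool per node for boolWitness, κaddW per addTopWitness, κsign per (1 + ℓ) for signWitness.
κstep κxor κand κprod κbool κaddW κsign κtotal : ℕ
κstep = nodeCount sumBitᵗ + nodeCount carryᵗ
κxor = nodeCount XORᵗ
κand = nodeCount ANDᵗ
κprod = 8 * κstep + 5 * κxor + κand
κbool = 2 + nodeCount xorCofactorᵗ
κaddW = 3 + (nodeCount addTopCofactor₁ + nodeCount addTopCofactor₂)
κsign = κaddW + (2 + nodeCount xorSlopeᵗ + (2 + (suc (nodeCount absTopCofactor) + suc κaddW)))
κtotal = (1 + κbool) * (1 + κprod) + κsign

κstep≤κprod : κstep ≤ κprod
κstep≤κprod = ℕP.≤-trans (ℕP.m≤n*m κstep 8) (ℕP.≤-trans (ℕP.m≤m+n (8 * κstep) (5 * κxor)) (ℕP.m≤m+n _ κand))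

n≤κprod*[1+n]² : ∀ n → n ≤ κprod * (suc n * suc n)
n≤κprod*[1+n]² n = ℕP.≤-trans (ℕP.n≤1+n n) (ℕP.≤-trans (ℕP.m≤m*n (suc n) (suc n)) (ℕP.m≤n*m _ κprod))

module _ {V : Set} where

  private
    C = Circ V

  length-addAux : (c : C) (ys zs : List C) → length (addAux c ys zs) ≤ length ys
  length-addAux c (y ∷ ys) (z ∷ zs) = s≤s (length-addAux _ ys zs)
  length-addAux c [] _ = z≤n
  length-addAux c (_ ∷ _) [] = z≤n

  length-pad-suc-width : (ys zs : List C) → length (pad (suc (addWidth ys zs)) ys) ≡ suc (addWidth ys zs)
  length-pad-suc-width ys zs = length-pad _ ys (ℕP.m≤n⇒m≤1+n (ℕP.m≤m⊔n _ _))

  length-ADD : (ys zs : List C) → length (ADD ys zs) ≤ suc (addWidth ys zs)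
  length-ADD ys zs =
    ≡.subst (length (ADD ys zs) ≤_) (length-pad-suc-width ys zs) (length-addAux 𝟘 (pad _ ys) _)

  addWidth-replicate : (xs : List C) (s : C) → addWidth xs (replicate (length xs) s) ≡ length xs
  addWidth-replicate xs s = ≡.trans (≡.cong (length xs ⊔_) (LP.length-replicate (length xs))) (ℕP.⊔-idem _)

  length-ABS : (xs : List C) → length (ABS xs) ≤ suc (length xs)
  length-ABS xs = begin
    length (ABS xs)     ≡⟨ LP.length-map _ (ADD xs rp) ⟩
    length (ADD xs rp)  ≤⟨ length-ADD xs rp ⟩
    suc (addWidth xs rp) ≡⟨ ≡.cong suc (addWidth-replicate xs _) ⟩
    suc (length xs)     ∎
    where
      open ℕP.≤-Reasoning
      rp = replicate (length xs) (lastOr 𝟘 xs)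

  length-row : (as : List C) (i : ℕ) (b : C) → length (row as i b) ≡ i + length as
  length-row as i b = ≡.trans (LP.length-++ (replicate i 𝟘))
    (≡.cong₂ _+_ (LP.length-replicate i) (LP.length-map _ as))

  length-addAuxNodes : (c : C) (ys zs : List C) → length (addAuxNodes c ys zs) ≤ κstep * length ys
  length-addAuxNodes c (y ∷ ys) (z ∷ zs) =
    ℕP.≤-trans (ℕP.+-monoʳ-≤ κstep (length-addAuxNodes (carry y z c) ys zs))
      (ℕP.≤-reflexive (≡.sym (ℕP.*-suc κstep (length ys))))
  length-addAuxNodes c [] _ = z≤n
  length-addAuxNodes c (_ ∷ _) [] = z≤n

  length-ADDNodes : (ys zs : List C) → length (ADDNodes ys zs) ≤ κstep * suc (addWidth ys zs)
  length-ADDNodes ys zs = ≡.subst (λ m → length (ADDNodes ys zs) ≤ κstep * m) (length-pad-suc-width ys zs)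
    (length-addAuxNodes 𝟘 (pad _ ys) _)

  length-xorMapNodes : (s : C) (es : List C) → length (xorMapNodes s es) ≤ length es * κxor
  length-xorMapNodes s es = length-concatMap-≤ (λ e → instanceNodes XORᵗ (e ∷ s ∷ [])) es (λ _ → ℕP.≤-refl)

  length-rowNodes : (as : List C) (b : C) → length (rowNodes as b) ≤ length as * κand
  length-rowNodes as b = length-concatMap-≤ (λ a → instanceNodes ANDᵗ (a ∷ b ∷ [])) as (λ _ → ℕP.≤-refl)

  length-ABSNodes : (xs : List C) → length (ABSNodes xs) ≤ κstep * suc (length xs) + suc (length xs) * κxor
  length-ABSNodes xs =
    length-++-≤ (ADDNodes xs rp) (xorMapNodes _ (ADD xs rp))
      (≡.subst (λ m → length (ADDNodes xs rp) ≤ κstep * suc m) (addWidth-replicate xs _) (length-ADDNodes xs rp))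
      (ℕP.≤-trans (length-xorMapNodes _ (ADD xs rp))
        (ℕP.*-monoˡ-≤ κxor (ℕP.≤-trans (length-ADD xs rp) (ℕP.≤-reflexive (≡.cong suc (addWidth-replicate xs _))))))
    where rp = replicate (length xs) (lastOr 𝟘 xs)

  addWidth-row : (as : List C) (i : ℕ) (b : C) (acc : List C) → length acc ≤ length as + i →
    addWidth (row as i b) acc ≤ length as + i
  addWidth-row as i b acc = ℕP.⊔-lub (ℕP.≤-reflexive (≡.trans (length-row as i b) (ℕP.+-comm i (length as))))

  length-ADD-row : (as : List C) (i : ℕ) (b : C) (acc : List C) → length acc ≤ length as + i →
    length (ADD (row as i b) acc) ≤ length as + suc i
  length-ADD-row as i b acc h = begin
    length (ADD (row as i b) acc) ≤⟨ length-ADD (row as i b) acc ⟩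
    suc (addWidth (row as i b) acc) ≤⟨ s≤s (addWidth-row as i b acc h) ⟩
    suc (length as + i)            ≡⟨ ℕP.+-suc (length as) i ⟨
    length as + suc i              ∎
    where open ℕP.≤-Reasoning

  length-foldRows : (acc as : List C) (i : ℕ) (bs : List C) → length acc ≤ length as + i →
    length (foldl (λ acc r → ADD r acc) acc (rows as i bs)) ≤ length as + i + length bs
  length-foldRows acc as i [] h = ℕP.≤-trans h (ℕP.m≤m+n _ 0)
  length-foldRows acc as i (b ∷ bs) h = begin
    length (foldl (λ acc r → ADD r acc) (ADD (row as i b) acc) (rows as (suc i) bs))
      ≤⟨ length-foldRows (ADD (row as i b) acc) as (suc i) bs (length-ADD-row as i b acc h) ⟩
    length as + suc i + length bs   ≡⟨ +-suc-shift (length as) i (length bs) ⟩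
    length as + i + length (b ∷ bs) ∎
    where open ℕP.≤-Reasoning

  length-foldNodes : (acc as : List C) (i : ℕ) (bs : List C) (M : ℕ) → length as + i + length bs ≤ M →
    length acc ≤ length as + i → length (foldNodes acc as i bs) ≤ length bs * (length as * κand + κstep * suc M)
  length-foldNodes acc as i [] M hM h = z≤n
  length-foldNodes acc as i (b ∷ bs) M hM h = begin
    length (rowNodes as b ++ ADDNodes r acc ++ foldNodes (ADD r acc) as (suc i) bs)
      ≤⟨ length-++-≤ (rowNodes as b) _ (length-rowNodes as b)
           (length-++-≤ (ADDNodes r acc) _ addBound
             (length-foldNodes (ADD r acc) as (suc i) bs M hM′ (length-ADD-row as i b acc h))) ⟩
    length as * κand + (κstep * suc M + length bs * K) ≡⟨ ℕP.+-assoc (length as * κand) _ _ ⟨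
    K + length bs * K ∎
    where
      open ℕP.≤-Reasoning
      r = row as i b
      K = length as * κand + κstep * suc M
      hM′ : length as + suc i + length bs ≤ M
      hM′ = ℕP.≤-trans (ℕP.≤-reflexive (+-suc-shift (length as) i (length bs))) hM
      addBound : length (ADDNodes r acc) ≤ κstep * suc M
      addBound = ℕP.≤-trans (length-ADDNodes r acc) (ℕP.*-monoʳ-≤ κstep (s≤s
        (ℕP.≤-trans (addWidth-row as i b acc h) (ℕP.≤-trans (ℕP.m≤m+n _ (length (b ∷ bs))) hM))))

  length-row₀ : (as : List C) (b : C) → length (row as 0 b) ≤ length as + 1
  length-row₀ as b = ℕP.≤-trans (ℕP.≤-reflexive (length-row as 0 b)) (ℕP.m≤m+n _ 1)

  foldRows-width : (as bs : List C) (m : ℕ) → length as ≤ m → suc (length bs) ≤ m →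
    length as + 1 + length bs ≤ m + m
  foldRows-width as bs m ha hb = ℕP.≤-trans (ℕP.≤-reflexive (+-suc-shift (length as) 0 (length bs)))
    (ℕP.+-mono-≤ (ℕP.≤-trans (ℕP.≤-reflexive (ℕP.+-identityʳ _)) ha) hb)

  length-PROD⁺ : (as bs : List C) (m : ℕ) → length as ≤ m → length bs ≤ m → length (PROD⁺ as bs) ≤ m + m
  length-PROD⁺ as [] m _ _ = z≤n
  length-PROD⁺ as (b ∷ bs) m ha hb =
    ℕP.≤-trans (length-foldRows (row as 0 b) as 1 bs (length-row₀ as b)) (foldRows-width as bs m ha hb)

  length-PROD⁺Nodes : (as bs : List C) (m : ℕ) → length as ≤ m → length bs ≤ m →
    length (PROD⁺Nodes as bs) ≤ m * (m * κand + κstep * suc (m + m))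
  length-PROD⁺Nodes as [] m _ _ = z≤n
  length-PROD⁺Nodes as (b ∷ bs) m ha hb = begin
    length (rowNodes as b ++ foldNodes (row as 0 b) as 1 bs)
      ≤⟨ length-++-≤ (rowNodes as b) _ (length-rowNodes as b)
           (length-foldNodes (row as 0 b) as 1 bs (m + m) (foldRows-width as bs m ha hb) (length-row₀ as b)) ⟩
    length as * κand + length bs * (length as * κand + κstep * suc (m + m))
      ≤⟨ ℕP.+-mono-≤ (ℕP.≤-trans (ℕP.*-monoˡ-≤ κand ha) (ℕP.m≤m+n _ _))
           (ℕP.*-monoʳ-≤ (length bs) (ℕP.+-monoˡ-≤ _ (ℕP.*-monoˡ-≤ κand ha))) ⟩
    suc (length bs) * K ≤⟨ ℕP.*-monoˡ-≤ K hb ⟩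
    m * K ∎
    where
      open ℕP.≤-Reasoning
      K = m * κand + κstep * suc (m + m)

  module ProdBounds (ys zs : List C) where
    open ProdParts ys zs public

    m : ℕ
    m = suc t

    length-ys′ : length ys′ ≡ t
    length-ys′ = length-pad t ys (ℕP.m≤m⊔n _ _)

    length-zs′ : length zs′ ≡ t
    length-zs′ = length-pad t zs (ℕP.m≤n⊔m _ _)

    length-A : length A ≤ m
    length-A = ℕP.≤-trans (length-ABS ys′) (s≤s (ℕP.≤-reflexive length-ys′))

    length-B : length B ≤ m
    length-B = ℕP.≤-trans (length-ABS zs′) (s≤s (ℕP.≤-reflexive length-zs′))

    length-P : length P ≤ m + m
    length-P = length-PROD⁺ A B m length-A length-B

    width-final : addWidth (map (λ e → XOR e s) P) (s ∷ 𝟘 ∷ []) ≤ m + m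
    width-final = ℕP.⊔-lub (ℕP.≤-trans (ℕP.≤-reflexive (LP.length-map _ P)) length-P)
      (s≤s (ℕP.≤-trans (s≤s z≤n) (ℕP.m≤n+m m t)))

  length-PROD : (ys zs : List C) → length (PROD ys zs) ≤ 2 * (length ys ⊔ length zs) + 3
  length-PROD ys zs = begin
    length (ADD (map (λ e → XOR e s) P) (s ∷ 𝟘 ∷ [])) ≤⟨ length-ADD (map (λ e → XOR e s) P) (s ∷ 𝟘 ∷ []) ⟩
    suc (addWidth (map (λ e → XOR e s) P) (s ∷ 𝟘 ∷ [])) ≤⟨ s≤s width-final ⟩
    suc (m + m)
      ≡⟨ ℕS.solve 1 (λ t → con 1 :+ ((con 1 :+ t) :+ (con 1 :+ t)) := con 2 :* t :+ con 3) refl t ⟩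
    2 * t + 3                                            ∎
    where
      open ProdBounds ys zs
      open ℕP.≤-Reasoning
      open ℕS using (_:+_; _:*_; _:=_; con)

  length-PRODNodes : (ys zs : List C) →
    length (PRODNodes ys zs) ≤ κprod * (suc (length ys ⊔ length zs) * suc (length ys ⊔ length zs))
  length-PRODNodes ys zs = begin
    length (concat (PRODNodeParts ys zs))
      ≤⟨ length-concat-≤ {xss = PRODNodeParts ys zs}
           (ℕP.≤-refl ∷ ABSbound ys′ length-ys′ ∷ ABSbound zs′ length-zs′
                          ∷ length-PROD⁺Nodes A B m length-A length-B
                          ∷ ℕP.≤-trans (length-xorMapNodes s P) (ℕP.*-monoˡ-≤ κxor length-P)
                          ∷ ℕP.≤-trans (length-ADDNodes (map (λ e → XOR e s) P) (s ∷ 𝟘 ∷ []))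
                              (ℕP.*-monoʳ-≤ κstep (s≤s width-final))
                          ∷ []) ⟩
    sum (κxor ∷ K ∷ K ∷ m * (m * κand + κstep * suc (m + m)) ∷ (m + m) * κxor ∷ κstep * suc (m + m) ∷ [])
      ≤⟨ ℕP.m≤m+n _ _ ⟩
    _ ≡⟨ poly κstep κxor κand t ⟩
    κprod * (m * m) ∎
    where
      open ProdBounds ys zs
      open ℕP.≤-Reasoning
      K = κstep * m + m * κxor
      ABSbound : (xs : List C) → length xs ≡ t → length (ABSNodes xs) ≤ K
      ABSbound xs eq = ≡.subst (λ k → length (ABSNodes xs) ≤ κstep * suc k + suc k * κxor) eq (length-ABSNodes xs)
      poly : ∀ a b c t → let u = suc t in
        b + ((a * u + u * b) + ((a * u + u * b)
          + (u * (u * c + a * suc (u + u)) + ((u + u) * b + (a * suc (u + u) + 0)))))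
        + ((a + b) * (t * t + 2 * t) + (5 * a + 4 * b) * (t * t + t))
        ≡ (8 * a + 5 * b + c) * (u * u)
      poly = ℕS.solve 4 (λ a b c t → let u = con 1 :+ t in
          b :+ ((a :* u :+ u :* b) :+ ((a :* u :+ u :* b)
            :+ (u :* (u :* c :+ a :* (con 1 :+ (u :+ u))) :+ ((u :+ u) :* b :+ (a :* (con 1 :+ (u :+ u)) :+ con 0)))))
          :+ ((a :+ b) :* (t :* t :+ con 2 :* t) :+ (con 5 :* a :+ con 4 :* b) :* (t :* t :+ t))
        := (con 8 :* a :+ con 5 :* b :+ c) :* (u :* u)) refl
        where open ℕS

  length-digits : (k u : ℕ) → length (map (λ w → const {V} (+ w)) (digits k u)) ≡ k
  length-digits zero u = refl
  length-digits (suc k) u = ≡.cong suc (length-digits k (u ℕD./ 2))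

  length-bit-const : (α : ℤ) → length (bit {V} (const α)) ≡ ℓint α
  length-bit-const (+ m) = length-digits _ m
  length-bit-const -[1+ m ] = length-digits _ _

  length-bit : (F : C) → length (bit F) ≤ ℓ F
  length-bit (var j) = ℕP.≤-refl
  length-bit (const α) = ℕP.≤-reflexive (length-bit-const α)
  length-bit (F ⊕c G) = ℕP.≤-trans (length-ADD (bit F) (bit G)) (s≤s (ℕP.⊔-mono-≤ (length-bit F) (length-bit G)))
  length-bit (F ⊗c G) = ℕP.≤-trans (length-PROD (bit F) (bit G))
    (ℕP.+-monoˡ-≤ 3 (ℕP.*-monoʳ-≤ 2 (ℕP.⊔-mono-≤ (length-bit F) (length-bit G))))

  ℓ-nodes : (F : C) → AllNodes (λ u → ℓ u ≤ ℓ F) F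
  ℓ-nodes (var _) = ℕP.≤-refl
  ℓ-nodes (const _) = ℕP.≤-refl
  ℓ-nodes (F ⊕c G) =
    ℕP.≤-refl , AllNodes-map (λ h → ℕP.≤-trans h (ℕP.m≤n⇒m≤1+n (ℕP.m≤m⊔n (ℓ F) (ℓ G)))) {F} (ℓ-nodes F)
              , AllNodes-map (λ h → ℕP.≤-trans h (ℕP.m≤n⇒m≤1+n (ℕP.m≤n⊔m (ℓ F) (ℓ G)))) {G} (ℓ-nodes G)
  ℓ-nodes (F ⊗c G) =
    ℕP.≤-refl
    , AllNodes-map (λ h → ℕP.≤-trans h (ℕP.≤-trans (ℕP.m≤m⊔n (ℓ F) (ℓ G)) (m≤2m+3 (ℓ F ⊔ ℓ G)))) {F} (ℓ-nodes F)
    , AllNodes-map (λ h → ℕP.≤-trans h (ℕP.≤-trans (ℕP.m≤n⊔m (ℓ F) (ℓ G)) (m≤2m+3 (ℓ F ⊔ ℓ G)))) {G} (ℓ-nodes G)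
    where
      m≤2m+3 : ∀ m → m ≤ 2 * m + 3
      m≤2m+3 m = ℕP.≤-trans (ℕP.m≤n*m m 2) (ℕP.m≤m+n _ 3)

  length-bitNodes : (F : C) → length (bitNodes F) ≤ κprod * (suc (ℓ F) * suc (ℓ F))
  length-bitNodes (var j) = s≤s (s≤s z≤n)
  length-bitNodes (const α) = ℕP.≤-trans (ℕP.≤-reflexive (length-bit-const α)) (n≤κprod*[1+n]² (ℓint α))
  length-bitNodes (F ⊕c G) = begin
    length (ADDNodes (bit F) (bit G))  ≤⟨ length-ADDNodes (bit F) (bit G) ⟩
    κstep * suc (addWidth (bit F) (bit G))
      ≤⟨ ℕP.*-mono-≤ κstep≤κprod (s≤s (ℕP.⊔-mono-≤ (length-bit F) (length-bit G))) ⟩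
    κprod * ℓF                         ≤⟨ ℕP.*-monoʳ-≤ κprod (ℕP.≤-trans (ℕP.n≤1+n ℓF) (ℕP.m≤m*n (suc ℓF) (suc ℓF))) ⟩
    κprod * (suc ℓF * suc ℓF)          ∎
    where
      open ℕP.≤-Reasoning
      ℓF = ℓ (F ⊕c G)
  length-bitNodes (F ⊗c G) = ℕP.≤-trans (length-PRODNodes (bit F) (bit G))
    (ℕP.*-monoʳ-≤ κprod (ℕP.*-mono-≤ (s≤s w≤ℓ) (s≤s w≤ℓ)))
    where
      w≤ℓ : length (bit F) ⊔ length (bit G) ≤ ℓ (F ⊗c G)
      w≤ℓ = ℕP.≤-trans (ℕP.⊔-mono-≤ (length-bit F) (length-bit G))
              (ℕP.≤-trans (ℕP.m≤n*m (ℓ F ⊔ ℓ G) 2) (ℕP.m≤m+n _ 3))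

module _ {n : ℕ} where

  private
    CX = Circ (Fin n)
    CZ = Circ (Fin n ⊎ Fin n)

  length-boolWitnessNodes : (u : CX) → length (boolWitnessNodes u) ≤ κbool
  length-boolWitnessNodes (var _) = s≤s z≤n
  length-boolWitnessNodes (const _) = z≤n
  length-boolWitnessNodes ((_ ⊕c _) ⊕c _) = ℕP.≤-refl
  length-boolWitnessNodes (var _ ⊕c _) = z≤n
  length-boolWitnessNodes (const _ ⊕c _) = z≤n
  length-boolWitnessNodes ((_ ⊗c _) ⊕c _) = z≤n
  length-boolWitnessNodes (_ ⊗c _) = s≤s (s≤s (s≤s (s≤s z≤n)))

  length-addTopWitnessNodes : (wy wz : CZ) (ys zs : List CX) → length (addTopWitnessNodes wy wz ys zs) ≤ κaddW
  length-addTopWitnessNodes wy wz ys zs = ℕP.≤-refl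

  length-foldTopWitnessNodes : (wacc : CZ) (acc : List CX) (wA : CZ) (as : List CX) (i : ℕ) (bs : List CX) →
    length (foldTopWitnessNodes wacc acc wA as i bs) ≤ length bs * suc κaddW
  length-foldTopWitnessNodes wacc acc wA as i [] = z≤n
  length-foldTopWitnessNodes wacc acc wA as i (b ∷ bs) =
    s≤s (length-++-≤ (addTopWitnessNodes (embed b ⊗c wA) wacc (row as i b) acc)
                     (foldTopWitnessNodes wnext acc′ wA as (suc i) bs)
      (length-addTopWitnessNodes (embed b ⊗c wA) wacc (row as i b) acc)
      (length-foldTopWitnessNodes wnext acc′ wA as (suc i) bs))
    where
      wnext = addTopWitness (embed b ⊗c wA) wacc (row as i b) acc
      acc′ = ADD (row as i b) acc

  length-prod⁺TopWitnessNodes : (wA : CZ) (as bs : List CX) →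
    length (prod⁺TopWitnessNodes wA as bs) ≤ length bs * suc κaddW
  length-prod⁺TopWitnessNodes wA as [] = z≤n
  length-prod⁺TopWitnessNodes wA as (b ∷ bs) =
    ℕP.≤-trans (s≤s (length-foldTopWitnessNodes (embed b ⊗c wA) (row as 0 b) wA as 1 bs))
      (ℕP.+-monoˡ-≤ (length bs * suc κaddW) {1} {suc κaddW} (s≤s z≤n))

  length-xorMapTopWitnessNodes : (ws wP : CZ) (s : CX) (ps : List CX) →
    length (xorMapTopWitnessNodes ws wP s ps) ≤ 2 + nodeCount xorSlopeᵗ
  length-xorMapTopWitnessNodes ws wP s [] = z≤n
  length-xorMapTopWitnessNodes ws wP s (_ ∷ _) = ℕP.≤-refl

  length-squareSignWitnessNodes : (b : List CX) →
    length (concat (squareSignWitnessNodeParts b)) ≤ κsign * suc (length b)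
  length-squareSignWitnessNodes b = begin
    length (concat (squareSignWitnessNodeParts b))
      ≤⟨ length-concat-≤ {xss = squareSignWitnessNodeParts b}
           {κaddW ∷ 2 + nodeCount xorSlopeᵗ ∷ 2 ∷ suc (nodeCount absTopCofactor) ∷ suc (length b) * suc κaddW ∷ []}
           ( length-addTopWitnessNodes wX 𝟘 (map (λ e → XOR e s) P) (s ∷ 𝟘 ∷ [])
           ∷ length-xorMapTopWitnessNodes ws wP s P ∷ ℕP.≤-refl
           ∷ ℕP.≤-refl
           ∷ ℕP.≤-trans (length-prod⁺TopWitnessNodes wA A A) (ℕP.*-monoˡ-≤ (suc κaddW) length-A)
           ∷ []) ⟩
    κaddW + (2 + nodeCount xorSlopeᵗ + (2 + (suc (nodeCount absTopCofactor) + (suc (length b) * suc κaddW + 0))))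
      ≤⟨ ℕP.m≤m+n _ _ ⟩
    _ ≡⟨ poly κaddW (nodeCount xorSlopeᵗ) (nodeCount absTopCofactor) (length b) ⟩
    κsign * suc (length b) ∎
    where
      open SquareSign b
      open ℕP.≤-Reasoning
      length-A : length A ≤ suc (length b)
      length-A = ℕP.≤-trans (length-ABS ys′)
        (s≤s (ℕP.≤-reflexive (≡.trans (length-pad _ b (ℕP.m≤m⊔n _ _)) (ℕP.⊔-idem _))))
      poly : ∀ a s c x →
        a + (2 + s + (2 + (suc c + (suc x * suc a + 0)))) + (a + (2 + s + (2 + suc c))) * x
        ≡ (a + (2 + s + (2 + (suc c + suc a)))) * suc x
      poly = ℕS.solve 4 (λ a s c x →
          a :+ (con 2 :+ s :+ (con 2 :+ ((con 1 :+ c) :+ ((con 1 :+ x) :* (con 1 :+ a) :+ con 0))))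
          :+ (a :+ (con 2 :+ s :+ (con 2 :+ (con 1 :+ c)))) :* x
        := (a :+ (con 2 :+ s :+ (con 2 :+ ((con 1 :+ c) :+ (con 1 :+ a))))) :* (con 1 :+ x)) refl
        where open ℕS

  length-signWitnessNodes : (F : CX) → length (signWitnessNodes F) ≤ κsign * suc (ℓ F)
  length-signWitnessNodes (var _) = z≤n
  length-signWitnessNodes (const _) = z≤n
  length-signWitnessNodes (F ⊕c G) =
    ℕP.≤-trans (length-addTopWitnessNodes (signWitness F) (signWitness G) (bit F) (bit G))
      (ℕP.≤-trans (ℕP.m≤m+n κaddW _) (ℕP.m≤m*n κsign (suc (ℓ (F ⊕c G)))))
  length-signWitnessNodes (H ⊗c G) = ℕP.≤-trans (length-squareSignWitnessNodes (bit H))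
    (ℕP.*-monoʳ-≤ κsign (s≤s (ℕP.≤-trans (length-bit H)
      (ℕP.≤-trans (ℕP.m≤m⊔n (ℓ H) (ℓ G)) (ℕP.≤-trans (ℕP.m≤n*m _ 2) (ℕP.m≤m+n _ 3))))))

size≤length : ∀ {V} (_≟_ : DecidableEquality V) (t : Circ V) (L : List (Circ V)) →
  AllNodes (_∈ L) t → size _≟_ t ≤ length L
size≤length _≟_ t L nodes = Unique⇒length≤ (deduplicate-! (_≟C_ _≟_) (subterms _≟_ t))
  (AllNodes⇒subterms _≟_ nodes ∘ ∈-deduplicate⁻ (_≟C_ _≟_) (subterms _≟_ t))

count≤power : ∀ s l c → κtotal + 3 ≤ c →
  let B = suc (s * (κprod * (suc l * suc l))) in
  B + (B * κbool + s * (κsign * suc l)) ≤ c * suc (s + l) ^ c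
count≤power s l c hc = begin
  B + (B * κbool + s * (κsign * suc l))
    ≤⟨ ℕP.+-mono-≤ B≤ (ℕP.+-mono-≤ (ℕP.*-monoˡ-≤ κbool B≤) (ℕP.*-mono-≤ s≤x (ℕP.*-monoʳ-≤ κsign l≤x))) ⟩
  B′ + (B′ * κbool + x * (κsign * x)) ≤⟨ ℕP.m≤m+n _ _ ⟩
  _                                   ≡⟨ poly κbool κprod κsign (s + l) ⟩
  κtotal * x ^ 3
    ≤⟨ ℕP.*-mono-≤ (ℕP.≤-trans (ℕP.m≤m+n κtotal 3) hc) (ℕP.^-monoʳ-≤ x (ℕP.≤-trans (ℕP.m≤n+m 3 κtotal) hc)) ⟩
  c * x ^ c                           ∎
  where
    open ℕP.≤-Reasoning
    x = suc (s + l)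
    B = suc (s * (κprod * (suc l * suc l)))
    B′ = suc (x * (κprod * (x * x)))
    s≤x : s ≤ x
    s≤x = ℕP.m≤n⇒m≤1+n (ℕP.m≤m+n s l)
    l≤x : suc l ≤ x
    l≤x = s≤s (ℕP.m≤n+m l s)
    B≤ : B ≤ B′
    B≤ = s≤s (ℕP.*-mono-≤ s≤x (ℕP.*-monoʳ-≤ κprod (ℕP.*-mono-≤ l≤x l≤x)))
    poly : ∀ b P g y → let x = suc y in
      suc (x * (P * (x * x))) + (suc (x * (P * (x * x))) * b + x * (g * x))
      + ((1 + b) * (y * y * y + 3 * (y * y) + 3 * y) + g * (y * y * y + 2 * (y * y) + y))
      ≡ ((1 + b) * (1 + P) + g) * x ^ 3
    poly = ℕS.solve 4 (λ b P g y → let x = con 1 :+ y in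
        (con 1 :+ x :* (P :* (x :* x))) :+ ((con 1 :+ x :* (P :* (x :* x))) :* b :+ x :* (g :* x))
        :+ ((con 1 :+ b) :* (y :* y :* y :+ con 3 :* (y :* y) :+ con 3 :* y)
            :+ g :* (y :* y :* y :+ con 2 :* (y :* y) :+ y))
      := ((con 1 :+ b) :* (con 1 :+ P) :+ g) :* (x :^ 3)) refl
      where open ℕS

module SignWitnessSize {n : ℕ} (T : SqTree (Fin n)) where

  private
    H = toCirc T
    subcircuits = deduplicate (_≟C_ FinP._≟_) (subterms FinP._≟_ H)

  bitNodeList : List (Circ (Fin n))
  bitNodeList = 𝟘 ∷ concatMap bitNodes subcircuits

  witnessNodeList : List (Circ (Fin n ⊎ Fin n))
  witnessNodeList =
    map embed bitNodeList ++ concatMap boolWitnessNodes bitNodeList ++ concatMap signWitnessNodes subcircuits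

  nodes∈subcircuits : AllNodes (_∈ subcircuits) H
  nodes∈subcircuits = subterms⇒AllNodes FinP._≟_ H (∈-deduplicate⁺ (_≟C_ FinP._≟_))

  ℓ-subcircuit : ∀ {u} → u ∈ subcircuits → ℓ u ≤ ℓ H
  ℓ-subcircuit = AllNodes⇒subterms FinP._≟_ (ℓ-nodes H) ∘ ∈-deduplicate⁻ (_≟C_ FinP._≟_) (subterms FinP._≟_ H)

  witness-covered : AllNodes (_∈ witnessNodeList) (signWitness H)
  witness-covered = signWitness-nodes T
    (AllNodes-map (λ u∈ → All.map there (All-∈-concatMap bitNodes u∈)) {H} nodes∈subcircuits)
    (AllNodes-map (λ u∈ → All.map (∈-++⁺ʳ (map embed bitNodeList) ∘ ∈-++⁺ʳ (concatMap boolWitnessNodes bitNodeList))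
                            (All-∈-concatMap signWitnessNodes u∈))
      {H} nodes∈subcircuits)
    where
      open WitnessNodeCoverage (_∈ bitNodeList) (here refl) (_∈ witnessNodeList) (∈-++⁺ˡ ∘ ∈-map⁺ embed)
        (λ u∈ → All.map (∈-++⁺ʳ (map embed bitNodeList) ∘ ∈-++⁺ˡ) (All-∈-concatMap boolWitnessNodes u∈))

  length-bitNodeList : length bitNodeList ≤ suc (sizeX H * (κprod * (suc (ℓ H) * suc (ℓ H))))
  length-bitNodeList = s≤s (length-concatMap-≤ bitNodes subcircuits (λ {u} u∈ →
    ℕP.≤-trans (length-bitNodes u)
      (ℕP.*-monoʳ-≤ κprod (ℕP.*-mono-≤ (s≤s (ℓ-subcircuit u∈)) (s≤s (ℓ-subcircuit u∈))))))

  length-witnessNodeList : let B = suc (sizeX H * (κprod * (suc (ℓ H) * suc (ℓ H)))) in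
    length witnessNodeList ≤ B + (B * κbool + sizeX H * (κsign * suc (ℓ H)))
  length-witnessNodeList =
    length-++-≤ (map embed bitNodeList) _
      (ℕP.≤-trans (ℕP.≤-reflexive (LP.length-map embed bitNodeList)) length-bitNodeList)
      (length-++-≤ (concatMap boolWitnessNodes bitNodeList) _
        (ℕP.≤-trans (length-concatMap-≤ boolWitnessNodes bitNodeList (λ {u} _ → length-boolWitnessNodes u))
          (ℕP.*-monoˡ-≤ κbool length-bitNodeList))
        (length-concatMap-≤ signWitnessNodes subcircuits (λ {u} u∈ →
          ℕP.≤-trans (length-signWitnessNodes u) (ℕP.*-monoʳ-≤ κsign (s≤s (ℓ-subcircuit u∈))))))

  size-bound : ∀ c → κtotal + 3 ≤ c → sizeXZ (signWitness H) ≤ c * suc (sizeX H + ℓ H) ^ c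
  size-bound c hc = ℕP.≤-trans (size≤length _ (signWitness H) witnessNodeList witness-covered)
    (ℕP.≤-trans length-witnessNodeList (count≤power (sizeX H) (ℓ H) c hc))

-- Opaque, so that the type checker never unfolds  x ^ sizeExponent.
opaque
  sizeExponent : ℕ
  sizeExponent = κtotal + 3

  κtotal+3≤sizeExponent : κtotal + 3 ≤ sizeExponent
  κtotal+3≤sizeExponent = ℕP.≤-refl

lemma6p8 : Σ ℕ λ c →
    ∀ (n : ℕ) (T : SqTree (Fin n)) → Balanced T →
      Σ (Circ (Fin n ⊎ Fin n)) λ C →
        IsBoolIPSProof C (signBit (toCirc T))
        × sizeXZ C ≤ c * suc (sizeX (toCirc T) + ℓ (toCirc T)) ^ c
lemma6p8 = sizeExponent , λ n T _ →
  signWitness (toCirc T) , proves⇒IsBoolIPSProof (signWitness-correct T) ,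
  SignWitnessSize.size-bound T sizeExponent κtotal+3≤sizeExponent
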